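{- Let $m>n$ be positive integers and $\nu$ a nonnegative integer. Then $$2^{ -2\nu-1}\binom{2\nu+1}{\nu+1}\,m^{ -1/2}\left(m^{1/2}-n^{1/2}\right)^{2\nu+2}=\sum_{\mu=0}^{\nu}\binom{\frac12+\nu}{\nu-\mu}\binom{\frac12+\nu}{\mu}m^{\nu-\mu}\left(m^{\mu-2\nu-1/2}P_{3+2\nu,\frac12-\mu}(m-n,n)-n^{\frac12+\mu}\right).$$
   Context: For an integer $a\ge2$ and real $b$, $P_{a,b}(X,Y):=\sum_{j=0}^{a-2}\binom{j+b-2}{j}X^j(X+Y)^{a-j-2}$. Binomial coefficients with non-integral arguments are defined via the Gamma function: $\binom{x}{k}:=\frac{\Gamma(x+1)}{\Gamma(k+1)\Gamma(x-k+1)}$. -}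

module Defs where

open import Data.Nat as ℕ using (ℕ; zero; suc)
open import Data.Nat.Combinatorics using (_C_)
open import Data.Integer as ℤ using (ℤ; +_; -[1+_])
open import Data.Rational as ℚ using (ℚ; 0ℚ; 1ℚ; _+_; _*_; _-_; _/_)

ℕ→ℚ : ℕ → ℚ
ℕ→ℚ k = + k / 1

-- 1/k as a rational (total; only used with k ≥ 1)
recip : ℕ → ℚ
recip zero    = 0ℚ
recip (suc k) = + 1 / suc k

_^ℚ_ : ℚ → ℕ → ℚ
q ^ℚ zero  = 1ℚ
q ^ℚ suc k = q * (q ^ℚ k)

zpow : ℕ → ℤ → ℚ
zpow m (+ k)     = ℕ→ℚ (m ℕ.^ k)
zpow m -[1+ k ]  = recip (m ℕ.^ suc k)

-- generalized binomial coefficient  binom(x, k) for rational x, natural k: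
-- x (x-1) ... (x-k+1) / k!   (= Γ(x+1)/(Γ(k+1)Γ(x-k+1)) whenever defined)
binomQ : ℚ → ℕ → ℚ
binomQ x zero    = 1ℚ
binomQ x (suc k) = binomQ x k * ((x - ℕ→ℚ k) * recip (suc k))

sumTo : ℕ → (ℕ → ℚ) → ℚ
sumTo zero    f = f 0
sumTo (suc n) f = sumTo n f + f (suc n)

P : ℕ → ℚ → ℚ → ℚ → ℚ
P a b X Y = sumTo (a ℕ.∸ 2) λ j →
  binomQ ((ℕ→ℚ j + b) - ℕ→ℚ 2) j * ((X ^ℚ j) * ((X + Y) ^ℚ ((a ℕ.∸ j) ℕ.∸ 2)))

-- The ring ℚ(√m, √n) presented formally as ℚ[x,y]/(x² - m, y² - n):
-- an element  a + b·√m + c·√n + d·√m·√n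
record QR (m n : ℕ) : Set where
  constructor ⟨_,_,_,_⟩
  field
    c0 cx cy cxy : ℚ

module _ {m n : ℕ} where
  open QR

  infixl 6 _⊕_ _⊖_
  infixl 7 _⊗_

  _⊕_ : QR m n → QR m n → QR m n
  u ⊕ v = ⟨ c0 u + c0 v , cx u + cx v , cy u + cy v , cxy u + cxy v ⟩

  ⊖_ : QR m n → QR m n
  ⊖ u = ⟨ ℚ.- c0 u , ℚ.- cx u , ℚ.- cy u , ℚ.- cxy u ⟩

  _⊖_ : QR m n → QR m n → QR m n
  u ⊖ v = u ⊕ (⊖ v)

  _⊗_ : QR m n → QR m n → QR m n
  u ⊗ v = ⟨ c0 u * c0 v + M * (cx u * cx v) + N * (cy u * cy v) + (M * N) * (cxy u * cxy v)
          , c0 u * cx v + cx u * c0 v + N * (cy u * cxy v + cxy u * cy v)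
          , c0 u * cy v + cy u * c0 v + M * (cx u * cxy v + cxy u * cx v)
          , c0 u * cxy v + cxy u * c0 v + cx u * cy v + cy u * cx v ⟩
    where
    M = ℕ→ℚ m
    N = ℕ→ℚ n

  ι : ℚ → QR m n
  ι q = ⟨ q , 0ℚ , 0ℚ , 0ℚ ⟩

  √m : QR m n
  √m = ⟨ 0ℚ , 1ℚ , 0ℚ , 0ℚ ⟩

  √n : QR m n
  √n = ⟨ 0ℚ , 0ℚ , 1ℚ , 0ℚ ⟩

  _^R_ : QR m n → ℕ → QR m n
  u ^R zero  = ι 1ℚ
  u ^R suc k = u ⊗ (u ^R k)

  m^[_+½] : ℤ → QR m n
  m^[ k +½] = ι (zpow m k) ⊗ √m

  n^[_+½] : ℤ → QR m n
  n^[ k +½] = ι (zpow n k) ⊗ √n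

½ : ℚ
½ = + 1 / 2

sumR : {m n : ℕ} → ℕ → (ℕ → QR m n) → QR m n
sumR zero    f = f 0
sumR (suc k) f = sumR k f ⊕ f (suc k)

-- Both sides lie in ℚ(√m, √n) with vanishing rational and √m√n parts, so it suffices to compare
-- the √m- and √n-components.  The √n-components agree term by term because
--   binom(ν+½, ν−μ) binom(ν+½, μ) = 2^(−2ν−1) C(2ν+1, ν+1) C(2ν+2, 2μ+1),
-- which follows by induction on μ from the ratio of consecutive terms.  For the √m-components,
-- P_{3+2ν,½−μ}(m−n, n) = Q(2μ+1) with Q(i) = Σ_j binom(j−1−i/2, j) (m−n)^j m^(2ν+1−j), a polynomial
-- of degree ≤ 2ν+1 in i.  Its (2ν+2)-th finite difference vanishes, i.e. the odd-indexed sum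
-- Σ C(2ν+2, 2μ+1) Q(2μ+1) equals the even-indexed one Σ C(2ν+2, 2k) Q(2k); by upper negation and
-- the binomial theorem Q(2k) = m^(2ν+1−k) n^k, and the even-indexed sum becomes m^ν times the
-- rational part of (√m − √n)^(2ν+2).

module Submission where

open import Defs
open import Algebra.Bundles using (CommutativeSemiring)
open import Algebra.Core using (Op₂)
open import Algebra.Structures using (IsCommutativeSemiring; IsCommutativeRing; IsSemigroup)
open import Data.Fin using (toℕ)
open import Data.Nat as ℕ using (ℕ; zero; suc; _≤_; _<_; z≤n; s≤s; _∸_; NonZero)
import Data.Nat.Properties as ℕ
open import Data.Nat.Combinatorics using (_C_; nCk+nC[k+1]≡[n+1]C[k+1]; k>n⇒nCk≡0; nC1≡n; nCk≡nC[n∸k])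
open import Data.Rational as ℚ using (ℚ; mkℚ; 0ℚ; 1ℚ)
import Data.Rational.Properties as ℚ
import Data.Rational.Unnormalised as ℚᵘ
import Data.Rational.Unnormalised.Properties as ℚᵘ
import Data.Integer as ℤ
import Data.Integer.Properties as ℤ
open import Data.Nat.Coprimality using (1-coprimeTo) renaming (sym to coprime-sym)
open import Level using (0ℓ)
open import Relation.Binary.PropositionalEquality hiding (J)

module BinomialCoefficient where
  open import Data.Nat using (_+_; _*_)
  open import Data.Nat.Solver using (module +-*-Solver)
  open +-*-Solver
  open ≡-Reasoning

  [k+1]*[n+1]C[k+1]≡[n+1]*nCk : ∀ n k → suc k * (suc n C suc k) ≡ suc n * (n C k)
  [k+1]*[n+1]C[k+1]≡[n+1]*nCk zero    zero    = refl
  [k+1]*[n+1]C[k+1]≡[n+1]*nCk zero    (suc k) = ℕ.*-zeroʳ (suc (suc k))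
  [k+1]*[n+1]C[k+1]≡[n+1]*nCk (suc n) zero    = trans (ℕ.*-identityˡ _) (trans (nC1≡n (suc (suc n))) (sym (ℕ.*-identityʳ (suc (suc n)))))
  [k+1]*[n+1]C[k+1]≡[n+1]*nCk (suc n) (suc k) = begin
    (2 + k) * ((2 + n) C (2 + k))
      ≡⟨ cong ((2 + k) *_) (nCk+nC[k+1]≡[n+1]C[k+1] (suc n) (suc k)) ⟨
    (2 + k) * (a + b)
      ≡⟨ solve 3 (λ k a b → (con 2 :+ k) :* (a :+ b) := a :+ (con 1 :+ k) :* a :+ (con 2 :+ k) :* b) refl k a b ⟩
    a + suc k * a + (2 + k) * b
      ≡⟨ cong₂ (λ x y → a + x + y) ([k+1]*[n+1]C[k+1]≡[n+1]*nCk n k) ([k+1]*[n+1]C[k+1]≡[n+1]*nCk n (suc k)) ⟩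
    a + suc n * (n C k) + suc n * (n C suc k)
      ≡⟨ solve 4 (λ a n c d → a :+ (con 1 :+ n) :* c :+ (con 1 :+ n) :* d := a :+ (con 1 :+ n) :* (c :+ d)) refl a n (n C k) (n C suc k) ⟩
    a + suc n * (n C k + n C suc k)
      ≡⟨ cong (λ x → a + suc n * x) (nCk+nC[k+1]≡[n+1]C[k+1] n k) ⟩
    a + suc n * a
      ≡⟨ solve 2 (λ a n → a :+ (con 1 :+ n) :* a := (con 2 :+ n) :* a) refl a n ⟩
    (2 + n) * a ∎
    where
    a b : ℕ
    a = suc n C suc k
    b = suc n C suc (suc k)

  [k+1]*[k+d]C[k+1]≡d*[k+d]Ck : ∀ d k → suc k * ((k + d) C suc k) ≡ d * ((k + d) C k)
  [k+1]*[k+d]C[k+1]≡d*[k+d]Ck d k = ℕ.+-cancelʳ-≡ (suc k * x) _ _ (begin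
    suc k * y + suc k * x
      ≡⟨ solve 3 (λ k x y → (con 1 :+ k) :* y :+ (con 1 :+ k) :* x := (con 1 :+ k) :* (x :+ y)) refl k x y ⟩
    suc k * (x + y)
      ≡⟨ cong (suc k *_) (nCk+nC[k+1]≡[n+1]C[k+1] (k + d) k) ⟩
    suc k * (suc (k + d) C suc k)
      ≡⟨ [k+1]*[n+1]C[k+1]≡[n+1]*nCk (k + d) k ⟩
    suc (k + d) * x
      ≡⟨ solve 3 (λ k d x → (con 1 :+ (k :+ d)) :* x := d :* x :+ (con 1 :+ k) :* x) refl k d x ⟩
    d * x + suc k * x ∎)
    where
    x y : ℕ
    x = (k + d) C k
    y = (k + d) C suc k

  -- (2μ+2)(2μ+3), with the constants first so that instance search sees it is nonzero.
  stepFactor : ℕ → ℕ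
  stepFactor μ = (2 + 2 * μ) * (3 + 2 * μ)

  stepFactor-*-C-odd : ∀ μ t → stepFactor μ * ((2 * (suc μ + t) + 2) C (2 * suc μ + 1))
                           ≡ stepFactor t * ((2 * (suc μ + t) + 2) C (2 * μ + 1))
  stepFactor-*-C-odd μ t = begin
    stepFactor μ * (L C (2 * suc μ + 1))
      ≡⟨ cong₂ (λ u v → u * (L C v)) factors≡ top≡ ⟩
    (2 + k) * (3 + k) * (L C (3 + k))
      ≡⟨ ℕ.*-assoc (2 + k) (3 + k) (L C (3 + k)) ⟩
    (2 + k) * ((3 + k) * (L C (3 + k)))
      ≡⟨ cong ((2 + k) *_) (subst (λ L′ → (3 + k) * (L′ C (3 + k)) ≡ (2 + 2 * t) * (L′ C (2 + k))) L≡₂ ([k+1]*[k+d]C[k+1]≡d*[k+d]Ck (2 + 2 * t) (2 + k))) ⟩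
    (2 + k) * ((2 + 2 * t) * (L C (2 + k)))
      ≡⟨ solve 3 (λ a b c → a :* (b :* c) := b :* (a :* c)) refl (2 + k) (2 + 2 * t) (L C (2 + k)) ⟩
    (2 + 2 * t) * ((2 + k) * (L C (2 + k)))
      ≡⟨ cong ((2 + 2 * t) *_) (subst (λ L′ → (2 + k) * (L′ C (2 + k)) ≡ (3 + 2 * t) * (L′ C suc k)) L≡₁ ([k+1]*[k+d]C[k+1]≡d*[k+d]Ck (3 + 2 * t) (suc k))) ⟩
    (2 + 2 * t) * ((3 + 2 * t) * (L C (suc k)))
      ≡⟨ ℕ.*-assoc (2 + 2 * t) (3 + 2 * t) (L C suc k) ⟨
    stepFactor t * (L C suc k)
      ≡⟨ cong (λ j → stepFactor t * (L C j)) (ℕ.+-comm 1 k) ⟩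
    stepFactor t * (L C (2 * μ + 1)) ∎
    where
    L k : ℕ
    L = 2 * (suc μ + t) + 2
    k = 2 * μ
    factors≡ : stepFactor μ ≡ (2 + k) * (3 + k)
    factors≡ = refl
    top≡ : 2 * suc μ + 1 ≡ 3 + k
    top≡ = solve 1 (λ μ → con 2 :* (con 1 :+ μ) :+ con 1 := con 3 :+ con 2 :* μ) refl μ
    L≡₁ : suc k + (3 + 2 * t) ≡ L
    L≡₁ = solve 2 (λ μ t → con 1 :+ con 2 :* μ :+ (con 3 :+ con 2 :* t) := con 2 :* (con 1 :+ μ :+ t) :+ con 2) refl μ t
    L≡₂ : (2 + k) + (2 + 2 * t) ≡ L
    L≡₂ = solve 2 (λ μ t → (con 2 :+ con 2 :* μ) :+ (con 2 :+ con 2 :* t) := con 2 :* (con 1 :+ μ :+ t) :+ con 2) refl μ t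

  C-central-step : ∀ t → (t + 1) * (t + 2) * ((2 * t + 3) C (t + 2)) ≡ (2 * t + 3) * (2 * t + 2) * ((2 * t + 1) C (t + 1))
  C-central-step t = begin
    (t + 1) * (t + 2) * ((2 * t + 3) C (t + 2))
      ≡⟨ cong (λ u → u * ((2 * t + 3) C (t + 2))) (solve 1 (λ t → (t :+ con 1) :* (t :+ con 2) := (con 1 :+ t) :* (con 2 :+ t)) refl t) ⟩
    (1 + t) * (2 + t) * ((2 * t + 3) C (t + 2))
      ≡⟨ cong₂ (λ n k → (1 + t) * (2 + t) * (n C k)) (ℕ.+-comm (2 * t) 3) (ℕ.+-comm t 2) ⟩
    (1 + t) * (2 + t) * ((3 + 2 * t) C (2 + t))
      ≡⟨ ℕ.*-assoc (1 + t) (2 + t) ((3 + 2 * t) C (2 + t)) ⟩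
    (1 + t) * ((2 + t) * ((3 + 2 * t) C (2 + t)))
      ≡⟨ cong ((1 + t) *_) ([k+1]*[n+1]C[k+1]≡[n+1]*nCk (2 + 2 * t) (1 + t)) ⟩
    (1 + t) * ((3 + 2 * t) * ((2 + 2 * t) C (1 + t)))
      ≡⟨ solve 3 (λ a b c → a :* (b :* c) := b :* (a :* c)) refl (1 + t) (3 + 2 * t) ((2 + 2 * t) C (1 + t)) ⟩
    (3 + 2 * t) * ((1 + t) * ((2 + 2 * t) C (1 + t)))
      ≡⟨ cong ((3 + 2 * t) *_) ([k+1]*[n+1]C[k+1]≡[n+1]*nCk (1 + 2 * t) t) ⟩
    (3 + 2 * t) * ((2 + 2 * t) * ((1 + 2 * t) C t))
      ≡⟨ cong (λ c → (3 + 2 * t) * ((2 + 2 * t) * c)) middle-symmetry ⟩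
    (3 + 2 * t) * ((2 + 2 * t) * ((1 + 2 * t) C (1 + t)))
      ≡⟨ solve 2 (λ t c → (con 3 :+ con 2 :* t) :* ((con 2 :+ con 2 :* t) :* c) := (con 2 :* t :+ con 3) :* (con 2 :* t :+ con 2) :* c)
                 refl t ((1 + 2 * t) C (1 + t)) ⟩
    (2 * t + 3) * (2 * t + 2) * ((1 + 2 * t) C (1 + t))
      ≡⟨ cong₂ (λ u v → (2 * t + 3) * (2 * t + 2) * (u C v)) (ℕ.+-comm 1 (2 * t)) (ℕ.+-comm 1 t) ⟩
    (2 * t + 3) * (2 * t + 2) * ((2 * t + 1) C (t + 1)) ∎
    where
    middle-symmetry : (1 + 2 * t) C t ≡ (1 + 2 * t) C (1 + t)
    middle-symmetry = trans (nCk≡nC[n∸k] t≤) (cong ((1 + 2 * t) C_) (begin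
      (1 + 2 * t) ∸ t     ≡⟨ cong (_∸ t) (solve 1 (λ t → con 1 :+ con 2 :* t := (con 1 :+ t) :+ t) refl t) ⟩
      (1 + t + t) ∸ t     ≡⟨ ℕ.m+n∸n≡m (1 + t) t ⟩
      1 + t               ∎))
      where
      t≤ : t ≤ 1 + 2 * t
      t≤ = ℕ.m≤n⇒m≤1+n (ℕ.m≤n*m t 2)

module Indices where
  open import Data.Nat using (_+_; _*_)
  open import Data.Nat.Solver using (module +-*-Solver)
  open +-*-Solver
  open ≡-Reasoning

  2[t+1]+1≡2+[2t+1] : ∀ t → 2 * suc t + 1 ≡ 2 + (2 * t + 1)
  2[t+1]+1≡2+[2t+1] = solve 1 (λ t → con 2 :* (con 1 :+ t) :+ con 1 := con 2 :+ (con 2 :* t :+ con 1)) refl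

  2[t+1]+1≡2t+3 : ∀ t → 2 * suc t + 1 ≡ 2 * t + 3
  2[t+1]+1≡2t+3 = solve 1 (λ t → con 2 :* (con 1 :+ t) :+ con 1 := con 2 :* t :+ con 3) refl

  even-complement : ∀ ν k → (2 * ν + 2) ∸ 2 * k ≡ 2 * (suc ν ∸ k)
  even-complement ν k = begin
    (2 * ν + 2) ∸ 2 * k
      ≡⟨ cong (_∸ 2 * k) (solve 1 (λ ν → con 2 :* ν :+ con 2 := con 2 :* (con 1 :+ ν)) refl ν) ⟩
    2 * suc ν ∸ 2 * k
      ≡⟨ ℕ.*-distribˡ-∸ 2 (suc ν) k ⟨
    2 * (suc ν ∸ k) ∎

  odd-complement : ∀ {ν μ} → μ ≤ ν → (2 * ν + 2) ∸ (2 * μ + 1) ≡ 2 * (ν ∸ μ) + 1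
  odd-complement {ν} {μ} μ≤ν = begin
    (2 * ν + 2) ∸ (2 * μ + 1)
      ≡⟨ cong (λ x → (2 * x + 2) ∸ (2 * μ + 1)) (ℕ.m∸n+n≡m μ≤ν) ⟨
    (2 * (d + μ) + 2) ∸ (2 * μ + 1)
      ≡⟨ cong (_∸ (2 * μ + 1)) (solve 2 (λ d μ → con 2 :* (d :+ μ) :+ con 2 := (con 2 :* d :+ con 1) :+ (con 2 :* μ :+ con 1)) refl d μ) ⟩
    ((2 * d + 1) + (2 * μ + 1)) ∸ (2 * μ + 1)
      ≡⟨ ℕ.m+n∸n≡m (2 * d + 1) (2 * μ + 1) ⟩
    2 * d + 1 ∎
    where
    d : ℕ
    d = ν ∸ μ

  [ν∸μ]+[1+ν]≡1+[2ν∸μ] : ∀ {ν μ} → μ ≤ ν → (ν ∸ μ) + suc ν ≡ suc (2 * ν ∸ μ)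
  [ν∸μ]+[1+ν]≡1+[2ν∸μ] {ν} {μ} μ≤ν = begin
    (ν ∸ μ) + suc ν     ≡⟨ ℕ.+-suc (ν ∸ μ) ν ⟩
    suc ((ν ∸ μ) + ν)   ≡⟨ cong suc (ℕ.+-∸-comm ν μ≤ν) ⟨
    suc ((ν + ν) ∸ μ)   ≡⟨ cong (λ x → suc (x ∸ μ)) (solve 1 (λ ν → ν :+ ν := con 2 :* ν) refl ν) ⟩
    suc (2 * ν ∸ μ)     ∎

  [1+2ν]∸k≡ν+[1+ν∸k] : ∀ {ν k} → k ≤ suc ν → suc (2 * ν) ∸ k ≡ ν + (suc ν ∸ k)
  [1+2ν]∸k≡ν+[1+ν∸k] {ν} {k} k≤ν+1 = begin
    suc (2 * ν) ∸ k     ≡⟨ cong (_∸ k) (solve 1 (λ ν → con 1 :+ con 2 :* ν := ν :+ (con 1 :+ ν)) refl ν) ⟩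
    (ν + suc ν) ∸ k     ≡⟨ ℕ.+-∸-assoc ν k≤ν+1 ⟩
    ν + (suc ν ∸ k)     ∎

module SemiringSum
  {A : Set} {_+_ _*_ : Op₂ A} {0# 1# : A}
  (isCommutativeSemiring : IsCommutativeSemiring _≡_ _+_ _*_ 0# 1#)
  (sum : ℕ → (ℕ → A) → A)
  (sum-zero : ∀ f → sum 0 f ≡ f 0)
  (sum-suc : ∀ L f → sum (suc L) f ≡ sum L f + f (suc L))
  where

  semiring : CommutativeSemiring 0ℓ 0ℓ
  semiring = record { isCommutativeSemiring = isCommutativeSemiring }

  open CommutativeSemiring semiring
    using (+-assoc; +-comm; +-identityˡ; +-identityʳ; *-identityˡ; distribˡ; +-monoid)
  open import Algebra.Properties.CommutativeSemigroup (CommutativeSemiring.+-commutativeSemigroup semiring)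
    using (interchange)
  open import Algebra.Properties.Monoid.Sum +-monoid using (sum⁺-syntax)
  open import Algebra.Properties.Semiring.Mult (CommutativeSemiring.semiring semiring) using (_×_; ×-assoc-*) public
  open import Algebra.Properties.Semiring.Exp (CommutativeSemiring.semiring semiring) using (_^_) public
  import Algebra.Properties.CommutativeSemiring.Binomial semiring as Binomial
  open import Data.Nat.Solver using (module +-*-Solver)
  open +-*-Solver using (solve; _:=_; _:+_; _:*_; con)
  open ≡-Reasoning

  sum-cong-≤ : ∀ L {f g : ℕ → A} → (∀ i → i ≤ L → f i ≡ g i) → sum L f ≡ sum L g
  sum-cong-≤ zero {f} {g} f≗g = begin
    sum 0 f ≡⟨ sum-zero f ⟩
    f 0     ≡⟨ f≗g 0 z≤n ⟩
    g 0     ≡⟨ sum-zero g ⟨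
    sum 0 g ∎
  sum-cong-≤ (suc L) {f} {g} f≗g = begin
    sum (suc L) f
      ≡⟨ sum-suc L f ⟩
    sum L f + f (suc L)
      ≡⟨ cong₂ _+_ (sum-cong-≤ L (λ i i≤L → f≗g i (ℕ.m≤n⇒m≤1+n i≤L))) (f≗g (suc L) ℕ.≤-refl) ⟩
    sum L g + g (suc L)
      ≡⟨ sum-suc L g ⟨
    sum (suc L) g ∎

  sum-cong : ∀ L {f g : ℕ → A} → (∀ i → f i ≡ g i) → sum L f ≡ sum L g
  sum-cong L f≗g = sum-cong-≤ L (λ i _ → f≗g i)

  sum-distrib : ∀ L (f g : ℕ → A) → sum L (λ i → f i + g i) ≡ sum L f + sum L g
  sum-distrib zero f g = trans (sum-zero _) (sym (cong₂ _+_ (sum-zero f) (sum-zero g)))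
  sum-distrib (suc L) f g = begin
    sum (suc L) (λ i → f i + g i)                     ≡⟨ sum-suc L _ ⟩
    sum L (λ i → f i + g i) + (f (suc L) + g (suc L)) ≡⟨ cong (_+ _) (sum-distrib L f g) ⟩
    (sum L f + sum L g) + (f (suc L) + g (suc L))     ≡⟨ interchange _ _ _ _ ⟩
    (sum L f + f (suc L)) + (sum L g + g (suc L))     ≡⟨ cong₂ _+_ (sum-suc L f) (sum-suc L g) ⟨
    sum (suc L) f + sum (suc L) g                     ∎

  sum-homo : (h : A → A) → (∀ a b → h (a + b) ≡ h a + h b) →
             ∀ L (f : ℕ → A) → h (sum L f) ≡ sum L (λ i → h (f i))
  sum-homo h h-homo zero f = trans (cong h (sum-zero f)) (sym (sum-zero _))
  sum-homo h h-homo (suc L) f = begin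
    h (sum (suc L) f)                     ≡⟨ cong h (sum-suc L f) ⟩
    h (sum L f + f (suc L))               ≡⟨ h-homo _ _ ⟩
    h (sum L f) + h (f (suc L))           ≡⟨ cong (_+ _) (sum-homo h h-homo L f) ⟩
    sum L (λ i → h (f i)) + h (f (suc L)) ≡⟨ sum-suc L _ ⟨
    sum (suc L) (λ i → h (f i))           ∎

  *-distribˡ-sum : ∀ a L (f : ℕ → A) → a * sum L f ≡ sum L (λ i → a * f i)
  *-distribˡ-sum a = sum-homo (a *_) (distribˡ a)

  sum-cons : ∀ L (f : ℕ → A) → sum (suc L) f ≡ f 0 + sum L (λ i → f (suc i))
  sum-cons zero f = begin
    sum 1 f                     ≡⟨ sum-suc 0 f ⟩
    sum 0 f + f 1               ≡⟨ cong (_+ f 1) (sum-zero f) ⟩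
    f 0 + f 1                   ≡⟨ cong (f 0 +_) (sum-zero _) ⟨
    f 0 + sum 0 (λ i → f (suc i)) ∎
  sum-cons (suc L) f = begin
    sum (suc (suc L)) f                                       ≡⟨ sum-suc (suc L) f ⟩
    sum (suc L) f + f (suc (suc L))                           ≡⟨ cong (_+ _) (sum-cons L f) ⟩
    (f 0 + sum L (λ i → f (suc i))) + f (suc (suc L))         ≡⟨ +-assoc _ _ _ ⟩
    f 0 + (sum L (λ i → f (suc i)) + f (suc (suc L)))         ≡⟨ cong (f 0 +_) (sum-suc L _) ⟨
    f 0 + sum (suc L) (λ i → f (suc i))                       ∎

  sum-vanishing : ∀ L (f : ℕ → A) → (∀ i → i ≤ L → f i ≡ 0#) → sum L f ≡ 0#
  sum-vanishing L f f≗0 = begin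
    sum L f          ≡⟨ sum-cong-≤ L f≗0 ⟩
    sum L (λ _ → 0#) ≡⟨ sum-homo (λ _ → 0#) (λ _ _ → sym (+-identityˡ 0#)) L f ⟨
    0#               ∎

  sum-trailing-zeros : ∀ d L (f : ℕ → A) → (∀ i → L < i → f i ≡ 0#) → sum (d ℕ.+ L) f ≡ sum L f
  sum-trailing-zeros zero L f f≗0 = refl
  sum-trailing-zeros (suc d) L f f≗0 = begin
    sum (suc (d ℕ.+ L)) f
      ≡⟨ sum-suc (d ℕ.+ L) f ⟩
    sum (d ℕ.+ L) f + f (suc (d ℕ.+ L))
      ≡⟨ cong₂ _+_ (sum-trailing-zeros d L f f≗0) (f≗0 _ (s≤s (ℕ.m≤n+m L d))) ⟩
    sum L f + 0#
      ≡⟨ +-identityʳ _ ⟩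
    sum L f ∎

  sum-parity : ∀ ν (f : ℕ → A) →
    sum (2 ℕ.* ν ℕ.+ 2) f ≡ sum (suc ν) (λ k → f (2 ℕ.* k)) + sum ν (λ μ → f (2 ℕ.* μ ℕ.+ 1))
  sum-parity zero f = begin
    sum 2 f
      ≡⟨ trans (sum-suc 1 f) (cong (_+ f 2) (trans (sum-suc 0 f) (cong (_+ f 1) (sum-zero f)))) ⟩
    (f 0 + f 1) + f 2
      ≡⟨ +-assoc _ _ _ ⟩
    f 0 + (f 1 + f 2)
      ≡⟨ cong (f 0 +_) (+-comm _ _) ⟩
    f 0 + (f 2 + f 1)
      ≡⟨ +-assoc _ _ _ ⟨
    (f 0 + f 2) + f 1
      ≡⟨ cong₂ _+_ (trans (sum-suc 0 _) (cong (_+ f 2) (sum-zero _))) (sum-zero _) ⟨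
    sum 1 (λ k → f (2 ℕ.* k)) + sum 0 (λ μ → f (2 ℕ.* μ ℕ.+ 1)) ∎
  sum-parity (suc ν) f = begin
    sum (2 ℕ.* suc ν ℕ.+ 2) f
      ≡⟨ cong (λ L → sum L f) length≡ ⟩
    sum (suc (suc (2 ℕ.* ν ℕ.+ 2))) f
      ≡⟨ trans (sum-suc _ f) (cong (_+ _) (sum-suc _ f)) ⟩
    (sum (2 ℕ.* ν ℕ.+ 2) f + f odd) + f even
      ≡⟨ cong (λ s → (s + f odd) + f even) (sum-parity ν f) ⟩
    ((E + O) + f odd) + f even
      ≡⟨ cong (_+ f even) (+-assoc E O (f odd)) ⟩
    (E + (O + f odd)) + f even
      ≡⟨ +-assoc E _ _ ⟩
    E + ((O + f odd) + f even)
      ≡⟨ cong (E +_) (+-comm _ _) ⟩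
    E + (f even + (O + f odd))
      ≡⟨ +-assoc E _ _ ⟨
    (E + f even) + (O + f odd)
      ≡⟨ cong₂ _+_ (cong (λ k → E + f k) even≡) (cong (λ k → O + f k) odd≡) ⟩
    (E + f (2 ℕ.* suc (suc ν))) + (O + f (2 ℕ.* suc ν ℕ.+ 1))
      ≡⟨ cong₂ _+_ (sum-suc (suc ν) _) (sum-suc ν _) ⟨
    sum (suc (suc ν)) (λ k → f (2 ℕ.* k)) + sum (suc ν) (λ μ → f (2 ℕ.* μ ℕ.+ 1)) ∎
    where
    E O : A
    E = sum (suc ν) (λ k → f (2 ℕ.* k))
    O = sum ν (λ μ → f (2 ℕ.* μ ℕ.+ 1))
    odd even : ℕ
    odd  = suc (2 ℕ.* ν ℕ.+ 2)
    even = suc odd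
    length≡ : 2 ℕ.* suc ν ℕ.+ 2 ≡ suc (suc (2 ℕ.* ν ℕ.+ 2))
    length≡ = solve 1 (λ ν → con 2 :* (con 1 :+ ν) :+ con 2 := con 2 :+ (con 2 :* ν :+ con 2)) refl ν
    even≡ : suc (suc (2 ℕ.* ν ℕ.+ 2)) ≡ 2 ℕ.* suc (suc ν)
    even≡ = solve 1 (λ ν → con 2 :+ (con 2 :* ν :+ con 2) := con 2 :* (con 2 :+ ν)) refl ν
    odd≡ : suc (2 ℕ.* ν ℕ.+ 2) ≡ 2 ℕ.* suc ν ℕ.+ 1
    odd≡ = solve 1 (λ ν → con 1 :+ (con 2 :* ν :+ con 2) := con 2 :* (con 1 :+ ν) :+ con 1) refl ν

  sum≡∑ : ∀ L (f : ℕ → A) → sum L f ≡ ∑[ i ≤ L ] f (toℕ i)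
  sum≡∑ zero f = trans (sum-zero f) (sym (+-identityʳ (f 0)))
  sum≡∑ (suc L) f = trans (sum-cons L f) (cong (f 0 +_) (sum≡∑ L (λ i → f (suc i))))

  ×≡×1* : ∀ c a → c × a ≡ (c × 1#) * a
  ×≡×1* c a = begin
    c × a          ≡⟨ cong (c ×_) (*-identityˡ a) ⟨
    c × (1# * a)   ≡⟨ ×-assoc-* c 1# a ⟨
    (c × 1#) * a   ∎

  binomial-theorem : ∀ x y L → (x + y) ^ L ≡ sum L (λ k → (L C k) × ((x ^ k) * (y ^ (L ∸ k))))
  binomial-theorem x y L = trans (Binomial.theorem L x y) (sym (sum≡∑ L _))

module ℚ-Sum =
  SemiringSum (IsCommutativeRing.isCommutativeSemiring ℚ.+-*-isCommutativeRing) sumTo (λ _ → refl) (λ _ _ → refl)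

module ℚ-Arithmetic where
  open import Data.Rational using (_+_; _*_)
  open import Data.Rational.Solver using (module +-*-Solver)
  open +-*-Solver
  open ℚ-Sum using (_×_; _^_; ×≡×1*; binomial-theorem)

  ℕ→ℚ≡mkℚ : ∀ k → ℕ→ℚ k ≡ mkℚ (ℤ.+ k) 0 (coprime-sym (1-coprimeTo k))
  ℕ→ℚ≡mkℚ k = ℚ.normalize-coprime (coprime-sym (1-coprimeTo k))

  ℕ→ℚ-suc : ∀ k → ℕ→ℚ (suc k) ≡ 1ℚ + ℕ→ℚ k
  ℕ→ℚ-suc k = ℚ.toℚᵘ-injective (begin
    ℚ.toℚᵘ (ℕ→ℚ (suc k))                  ≡⟨ cong ℚ.toℚᵘ (ℕ→ℚ≡mkℚ (suc k)) ⟩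
    ℚᵘ.mkℚᵘ (ℤ.+ suc k) 0                   ≈⟨ ℚᵘ.*≡* cross-multiplied ⟩
    ℚᵘ.mkℚᵘ (ℤ.+ 1) 0 ℚᵘ.+ ℚᵘ.mkℚᵘ (ℤ.+ k) 0 ≡⟨ cong (λ q → ℚ.toℚᵘ 1ℚ ℚᵘ.+ ℚ.toℚᵘ q) (ℕ→ℚ≡mkℚ k) ⟨
    ℚ.toℚᵘ 1ℚ ℚᵘ.+ ℚ.toℚᵘ (ℕ→ℚ k)          ≈⟨ ℚ.toℚᵘ-homo-+ 1ℚ (ℕ→ℚ k) ⟨
    ℚ.toℚᵘ (1ℚ + ℕ→ℚ k)                   ∎)
    where
    open ℚᵘ.≃-Reasoning
    cross-multiplied : ℤ.+ suc k ℤ.* ℤ.+ 1 ≡ (ℤ.+ 1 ℤ.* ℤ.+ 1 ℤ.+ ℤ.+ k ℤ.* ℤ.+ 1) ℤ.* ℤ.+ 1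
    cross-multiplied = trans (ℤ.*-identityʳ _) (sym (trans (ℤ.*-identityʳ _) (cong (ℤ._+_ (ℤ.+ 1)) (ℤ.*-identityʳ (ℤ.+ k)))))

  ℕ→ℚ-+ : ∀ a b → ℕ→ℚ (a ℕ.+ b) ≡ ℕ→ℚ a + ℕ→ℚ b
  ℕ→ℚ-+ zero b = sym (ℚ.+-identityˡ (ℕ→ℚ b))
  ℕ→ℚ-+ (suc a) b = begin
    ℕ→ℚ (suc (a ℕ.+ b))           ≡⟨ ℕ→ℚ-suc (a ℕ.+ b) ⟩
    1ℚ + ℕ→ℚ (a ℕ.+ b)            ≡⟨ cong (1ℚ +_) (ℕ→ℚ-+ a b) ⟩
    1ℚ + (ℕ→ℚ a + ℕ→ℚ b)          ≡⟨ ℚ.+-assoc 1ℚ (ℕ→ℚ a) (ℕ→ℚ b) ⟨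
    (1ℚ + ℕ→ℚ a) + ℕ→ℚ b          ≡⟨ cong (_+ ℕ→ℚ b) (ℕ→ℚ-suc a) ⟨
    ℕ→ℚ (suc a) + ℕ→ℚ b           ∎
    where open ≡-Reasoning

  ℕ→ℚ-* : ∀ a b → ℕ→ℚ (a ℕ.* b) ≡ ℕ→ℚ a * ℕ→ℚ b
  ℕ→ℚ-* zero b = sym (ℚ.*-zeroˡ (ℕ→ℚ b))
  ℕ→ℚ-* (suc a) b = begin
    ℕ→ℚ (b ℕ.+ a ℕ.* b)
      ≡⟨ ℕ→ℚ-+ b (a ℕ.* b) ⟩
    ℕ→ℚ b + ℕ→ℚ (a ℕ.* b)
      ≡⟨ cong (ℕ→ℚ b +_) (ℕ→ℚ-* a b) ⟩
    ℕ→ℚ b + ℕ→ℚ a * ℕ→ℚ b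
      ≡⟨ solve 2 (λ x y → y :+ x :* y := (con 1ℚ :+ x) :* y) refl (ℕ→ℚ a) (ℕ→ℚ b) ⟩
    (1ℚ + ℕ→ℚ a) * ℕ→ℚ b
      ≡⟨ cong (_* ℕ→ℚ b) (ℕ→ℚ-suc a) ⟨
    ℕ→ℚ (suc a) * ℕ→ℚ b ∎
    where open ≡-Reasoning

  ℕ→ℚ-affine : ∀ a x b → ℕ→ℚ (a ℕ.* x ℕ.+ b) ≡ ℕ→ℚ a * ℕ→ℚ x + ℕ→ℚ b
  ℕ→ℚ-affine a x b = trans (ℕ→ℚ-+ (a ℕ.* x) b) (cong (_+ ℕ→ℚ b) (ℕ→ℚ-* a x))

  ℕ→ℚ-^ : ∀ a e → ℕ→ℚ (a ℕ.^ e) ≡ ℕ→ℚ a ^ℚ e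
  ℕ→ℚ-^ a zero = refl
  ℕ→ℚ-^ a (suc e) = trans (ℕ→ℚ-* a (a ℕ.^ e)) (cong (ℕ→ℚ a *_) (ℕ→ℚ-^ a e))

  *-recip : ∀ k .{{_ : NonZero k}} → ℕ→ℚ k * recip k ≡ 1ℚ
  *-recip (suc k) = begin
    ℕ→ℚ (suc k) * recip (suc k) ≡⟨ cong₂ _*_ (ℕ→ℚ≡mkℚ (suc k)) (ℚ.normalize-coprime (1-coprimeTo (suc k))) ⟩
    q * mkℚ (ℤ.+ 1) k (1-coprimeTo (suc k)) ≡⟨ ℚ.*-inverseʳ q ⟩
    1ℚ                          ∎
    where
    open ≡-Reasoning
    q : ℚ
    q = mkℚ (ℤ.+ suc k) 0 (coprime-sym (1-coprimeTo (suc k)))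

  *-inverse-unique : ∀ x y z → x * y ≡ 1ℚ → x * z ≡ 1ℚ → y ≡ z
  *-inverse-unique x y z xy≡1 xz≡1 = begin
    y             ≡⟨ ℚ.*-identityʳ y ⟨
    y * 1ℚ        ≡⟨ cong (y *_) xz≡1 ⟨
    y * (x * z)   ≡⟨ solve 3 (λ x y z → y :* (x :* z) := (x :* y) :* z) refl x y z ⟩
    (x * y) * z   ≡⟨ cong (_* z) xy≡1 ⟩
    1ℚ * z        ≡⟨ ℚ.*-identityˡ z ⟩
    z             ∎
    where open ≡-Reasoning

  *-recip-* : ∀ a b .{{_ : NonZero a}} .{{_ : NonZero b}} → ℕ→ℚ a * recip (a ℕ.* b) ≡ recip b
  *-recip-* a b = *-inverse-unique (ℕ→ℚ b) _ _ b*[a*r]≡1 (*-recip b)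
    where
    r : ℚ
    r = recip (a ℕ.* b)
    b*[a*r]≡1 : ℕ→ℚ b * (ℕ→ℚ a * r) ≡ 1ℚ
    b*[a*r]≡1 = begin
      ℕ→ℚ b * (ℕ→ℚ a * r)  ≡⟨ solve 3 (λ a b r → b :* (a :* r) := (a :* b) :* r) refl (ℕ→ℚ a) (ℕ→ℚ b) r ⟩
      (ℕ→ℚ a * ℕ→ℚ b) * r  ≡⟨ cong (_* r) (ℕ→ℚ-* a b) ⟨
      ℕ→ℚ (a ℕ.* b) * r    ≡⟨ *-recip (a ℕ.* b) {{ℕ.m*n≢0 a b}} ⟩
      1ℚ                   ∎
      where open ≡-Reasoning

  recip-*-ℕ→ℚ : ∀ k .{{_ : NonZero k}} p → recip k * (ℕ→ℚ k * p) ≡ p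
  recip-*-ℕ→ℚ k p = begin
    recip k * (ℕ→ℚ k * p)  ≡⟨ ℚ.*-assoc (recip k) (ℕ→ℚ k) p ⟨
    (recip k * ℕ→ℚ k) * p  ≡⟨ cong (_* p) (trans (ℚ.*-comm (recip k) (ℕ→ℚ k)) (*-recip k)) ⟩
    1ℚ * p                 ≡⟨ ℚ.*-identityˡ p ⟩
    p                      ∎
    where open ≡-Reasoning

  ℕ→ℚ-*-cancelˡ : ∀ k .{{_ : NonZero k}} {p q} → ℕ→ℚ k * p ≡ ℕ→ℚ k * q → p ≡ q
  ℕ→ℚ-*-cancelˡ k {p} {q} kp≡kq = begin
    p                      ≡⟨ recip-*-ℕ→ℚ k p ⟨
    recip k * (ℕ→ℚ k * p)  ≡⟨ cong (recip k *_) kp≡kq ⟩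
    recip k * (ℕ→ℚ k * q)  ≡⟨ recip-*-ℕ→ℚ k q ⟩
    q                      ∎
    where open ≡-Reasoning

  ^≡^ℚ : ∀ x n → x ^ n ≡ x ^ℚ n
  ^≡^ℚ x zero    = refl
  ^≡^ℚ x (suc n) = cong (x *_) (^≡^ℚ x n)

  ×≡ℕ→ℚ* : ∀ c a → c × a ≡ ℕ→ℚ c * a
  ×≡ℕ→ℚ* c a = trans (×≡×1* c a) (cong (_* a) (×1≡ℕ→ℚ c))
    where
    ×1≡ℕ→ℚ : ∀ c → c × 1ℚ ≡ ℕ→ℚ c
    ×1≡ℕ→ℚ zero    = refl
    ×1≡ℕ→ℚ (suc c) = trans (cong (1ℚ +_) (×1≡ℕ→ℚ c)) (sym (ℕ→ℚ-suc c))

  binomial-theorem-ℚ : ∀ x y k → (x + y) ^ℚ k ≡ sumTo k (λ j → ℕ→ℚ (k C j) * (x ^ℚ j * y ^ℚ (k ∸ j)))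
  binomial-theorem-ℚ x y k = begin
    (x + y) ^ℚ k
      ≡⟨ ^≡^ℚ (x + y) k ⟨
    (x + y) ^ k
      ≡⟨ binomial-theorem x y k ⟩
    sumTo k (λ j → (k C j) × (x ^ j * y ^ (k ∸ j)))
      ≡⟨ ℚ-Sum.sum-cong k (λ j → trans (×≡ℕ→ℚ* (k C j) _) (cong (ℕ→ℚ (k C j) *_) (cong₂ _*_ (^≡^ℚ x j) (^≡^ℚ y (k ∸ j))))) ⟩
    sumTo k (λ j → ℕ→ℚ (k C j) * (x ^ℚ j * y ^ℚ (k ∸ j))) ∎
    where open ≡-Reasoning

  ^ℚ-+ : ∀ x a b → x ^ℚ (a ℕ.+ b) ≡ x ^ℚ a * x ^ℚ b
  ^ℚ-+ x zero    b = sym (ℚ.*-identityˡ (x ^ℚ b))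
  ^ℚ-+ x (suc a) b = trans (cong (x *_) (^ℚ-+ x a b)) (sym (ℚ.*-assoc x (x ^ℚ a) (x ^ℚ b)))

module FiniteDifference where
  open import Data.Rational using (_+_; _*_; _-_; -_)
  open import Data.Rational.Solver using (module +-*-Solver)
  open +-*-Solver
  open ℚ-Arithmetic
  open ℚ-Sum using (sum-cong; sum-cons; sum-distrib; sum-homo; sum-trailing-zeros)

  Δ : (ℕ → ℚ) → ℕ → ℚ
  Δ f i = f (suc i) - f i

  DegreeBelow : ℕ → (ℕ → ℚ) → Set
  DegreeBelow zero    f = ∀ i → f i ≡ 0ℚ
  DegreeBelow (suc M) f = DegreeBelow M (Δ f)

  degreeBelow-cong : ∀ M {f g : ℕ → ℚ} → (∀ i → f i ≡ g i) → DegreeBelow M f → DegreeBelow M g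
  degreeBelow-cong zero    f≗g f≗0 i = trans (sym (f≗g i)) (f≗0 i)
  degreeBelow-cong (suc M) f≗g = degreeBelow-cong M (λ i → cong₂ _-_ (f≗g (suc i)) (f≗g i))

  degreeBelow-+ : ∀ M (f g : ℕ → ℚ) → DegreeBelow M f → DegreeBelow M g → DegreeBelow M (λ i → f i + g i)
  degreeBelow-+ zero    f g f≗0 g≗0 i = trans (cong₂ _+_ (f≗0 i) (g≗0 i)) (ℚ.+-identityˡ 0ℚ)
  degreeBelow-+ (suc M) f g df dg = degreeBelow-cong M Δ-+ (degreeBelow-+ M (Δ f) (Δ g) df dg)
    where
    Δ-+ : ∀ i → Δ f i + Δ g i ≡ Δ (λ j → f j + g j) i
    Δ-+ i = solve 4 (λ a b c d → (a :- c) :+ (b :- d) := (a :+ b) :- (c :+ d)) refl (f (suc i)) (g (suc i)) (f i) (g i)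

  degreeBelow-scale : ∀ M a (f : ℕ → ℚ) → DegreeBelow M f → DegreeBelow M (λ i → a * f i)
  degreeBelow-scale zero    a f f≗0 i = trans (cong (a *_) (f≗0 i)) (ℚ.*-zeroʳ a)
  degreeBelow-scale (suc M) a f df = degreeBelow-cong M Δ-scale (degreeBelow-scale M a (Δ f) df)
    where
    Δ-scale : ∀ i → a * Δ f i ≡ Δ (λ j → a * f j) i
    Δ-scale i = solve 3 (λ a b c → a :* (b :- c) := a :* b :- a :* c) refl a (f (suc i)) (f i)

  degreeBelow-suc : ∀ M (f : ℕ → ℚ) → DegreeBelow M f → DegreeBelow (suc M) f
  degreeBelow-suc zero    f f≗0 i = trans (cong₂ _-_ (f≗0 (suc i)) (f≗0 i)) (ℚ.+-inverseʳ 0ℚ)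
  degreeBelow-suc (suc M) f df  = degreeBelow-suc M (Δ f) df

  degreeBelow-≤ : ∀ {M M′} {f : ℕ → ℚ} → M ≤ M′ → DegreeBelow M f → DegreeBelow M′ f
  degreeBelow-≤ {M} {M′} {f} M≤M′ df = subst (λ K → DegreeBelow K f) (ℕ.m∸n+n≡m M≤M′) (raise (M′ ∸ M) df)
    where
    raise : ∀ d → DegreeBelow M f → DegreeBelow (d ℕ.+ M) f
    raise zero    df = df
    raise (suc d) df = degreeBelow-suc (d ℕ.+ M) f (raise d df)

  degreeBelow-*-linear : ∀ M α β (f : ℕ → ℚ) → DegreeBelow M f →
                         DegreeBelow (suc M) (λ i → f i * (α + ℕ→ℚ i * β))
  degreeBelow-*-linear zero α β f f≗0 =
    degreeBelow-suc 0 _ (λ i → trans (cong (_* (α + ℕ→ℚ i * β)) (f≗0 i)) (ℚ.*-zeroˡ (α + ℕ→ℚ i * β)))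
  degreeBelow-*-linear (suc M) α β f df =
    degreeBelow-cong (suc M) Δ-product
      (degreeBelow-+ (suc M) (λ i → Δ f i * ((α + β) + ℕ→ℚ i * β)) (λ i → β * f i)
        (degreeBelow-*-linear M (α + β) β (Δ f) df) (degreeBelow-scale (suc M) β f df))
    where
    Δ-product : ∀ i → Δ f i * ((α + β) + ℕ→ℚ i * β) + β * f i ≡ Δ (λ j → f j * (α + ℕ→ℚ j * β)) i
    Δ-product i = begin
      Δ f i * ((α + β) + ℕ→ℚ i * β) + β * f i
        ≡⟨ solve 5 (λ a b c α β → (a :- b) :* ((α :+ β) :+ c :* β) :+ β :* b
                                 := a :* (α :+ (con 1ℚ :+ c) :* β) :- b :* (α :+ c :* β))
                   refl (f (suc i)) (f i) (ℕ→ℚ i) α β ⟩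
      f (suc i) * (α + (1ℚ + ℕ→ℚ i) * β) - f i * (α + ℕ→ℚ i * β)
        ≡⟨ cong (λ x → f (suc i) * (α + x * β) - f i * (α + ℕ→ℚ i * β)) (ℕ→ℚ-suc i) ⟨
      Δ (λ j → f j * (α + ℕ→ℚ j * β)) i ∎
      where open ≡-Reasoning

  degreeBelow-sumTo : ∀ K {M} (g : ℕ → ℕ → ℚ) → (∀ j → j ≤ K → DegreeBelow M (λ i → g i j)) →
                      DegreeBelow M (λ i → sumTo K (g i))
  degreeBelow-sumTo zero    g dg = dg 0 z≤n
  degreeBelow-sumTo (suc K) {M} g dg =
    degreeBelow-+ M (λ i → sumTo K (g i)) (λ i → g i (suc K))
      (degreeBelow-sumTo K {M} g (λ j j≤K → dg j (ℕ.m≤n⇒m≤1+n j≤K))) (dg (suc K) ℕ.≤-refl)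

  sign : ℕ → ℚ
  sign zero    = 1ℚ
  sign (suc i) = - sign i

  alternatingSum : ℕ → (ℕ → ℚ) → ℚ
  alternatingSum M f = sumTo M (λ i → sign i * (ℕ→ℚ (M C i) * f i))

  alternatingSum-linear : ∀ M (f g : ℕ → ℚ) → alternatingSum M (λ i → f i - g i) ≡ alternatingSum M f - alternatingSum M g
  alternatingSum-linear M f g = begin
    sumTo M (λ i → sign i * (ℕ→ℚ (M C i) * (f i - g i)))          ≡⟨ sum-cong M termwise ⟩
    sumTo M (λ i → sign i * (ℕ→ℚ (M C i) * f i) + - (sign i * (ℕ→ℚ (M C i) * g i)))
      ≡⟨ sum-distrib M _ _ ⟩
    alternatingSum M f + sumTo M (λ i → - (sign i * (ℕ→ℚ (M C i) * g i)))
      ≡⟨ cong (alternatingSum M f +_) (sum-homo -_ ℚ.neg-distrib-+ M _) ⟨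
    alternatingSum M f - alternatingSum M g ∎
    where
    open ≡-Reasoning
    termwise : ∀ i → sign i * (ℕ→ℚ (M C i) * (f i - g i)) ≡ sign i * (ℕ→ℚ (M C i) * f i) + - (sign i * (ℕ→ℚ (M C i) * g i))
    termwise i = solve 4 (λ s c x y → s :* (c :* (x :- y)) := s :* (c :* x) :+ :- (s :* (c :* y))) refl (sign i) (ℕ→ℚ (M C i)) (f i) (g i)

  alternatingSum-suc : ∀ M (f : ℕ → ℚ) → alternatingSum (suc M) f ≡ alternatingSum M f - alternatingSum M (λ i → f (suc i))
  alternatingSum-suc M f = begin
    alternatingSum (suc M) f
      ≡⟨ sum-cons M _ ⟩
    t₀ + sumTo M (λ i → sign (suc i) * (ℕ→ℚ (suc M C suc i) * f (suc i)))
      ≡⟨ cong (t₀ +_) (trans (sum-cong M pascal) (sum-distrib M u (λ i → - v i))) ⟩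
    t₀ + (sumTo M u + sumTo M (λ i → - v i))
      ≡⟨ ℚ.+-assoc t₀ _ _ ⟨
    (t₀ + sumTo M u) + sumTo M (λ i → - v i)
      ≡⟨ cong₂ _+_ (sum-cons M g) (sum-homo -_ ℚ.neg-distrib-+ M v) ⟨
    sumTo (suc M) g - sumTo M v
      ≡⟨ cong (_- sumTo M v) (sum-trailing-zeros 1 M g g-vanishes) ⟩
    alternatingSum M f - alternatingSum M (λ i → f (suc i)) ∎
    where
    open ≡-Reasoning
    t₀ : ℚ
    t₀ = sign 0 * (ℕ→ℚ (suc M C 0) * f 0)
    g u v : ℕ → ℚ
    g i = sign i * (ℕ→ℚ (M C i) * f i)
    u i = sign (suc i) * (ℕ→ℚ (M C suc i) * f (suc i))
    v i = sign i * (ℕ→ℚ (M C i) * f (suc i))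
    pascal : ∀ i → sign (suc i) * (ℕ→ℚ (suc M C suc i) * f (suc i)) ≡ u i + - v i
    pascal i = begin
      - sign i * (ℕ→ℚ (suc M C suc i) * f (suc i))
        ≡⟨ cong (λ c → - sign i * (ℕ→ℚ c * f (suc i))) (nCk+nC[k+1]≡[n+1]C[k+1] M i) ⟨
      - sign i * (ℕ→ℚ (M C i ℕ.+ M C suc i) * f (suc i))
        ≡⟨ cong (λ c → - sign i * (c * f (suc i))) (ℕ→ℚ-+ (M C i) (M C suc i)) ⟩
      - sign i * ((ℕ→ℚ (M C i) + ℕ→ℚ (M C suc i)) * f (suc i))
        ≡⟨ solve 4 (λ s p q x → (:- s) :* ((p :+ q) :* x) := (:- s) :* (q :* x) :+ :- (s :* (p :* x)))
                   refl (sign i) (ℕ→ℚ (M C i)) (ℕ→ℚ (M C suc i)) (f (suc i)) ⟩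
      u i + - v i ∎
    g-vanishes : ∀ i → M < i → g i ≡ 0ℚ
    g-vanishes i M<i = begin
      sign i * (ℕ→ℚ (M C i) * f i) ≡⟨ cong (λ c → sign i * (ℕ→ℚ c * f i)) (k>n⇒nCk≡0 M<i) ⟩
      sign i * (0ℚ * f i)          ≡⟨ solve 2 (λ s x → s :* (con 0ℚ :* x) := con 0ℚ) refl (sign i) (f i) ⟩
      0ℚ                           ∎

  alternatingSum-vanishes : ∀ M (f : ℕ → ℚ) → DegreeBelow M f → alternatingSum M f ≡ 0ℚ
  alternatingSum-vanishes zero    f f≗0 = cong (λ x → 1ℚ * (1ℚ * x)) (f≗0 0)
  alternatingSum-vanishes (suc M) f df = begin
    alternatingSum (suc M) f
      ≡⟨ alternatingSum-suc M f ⟩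
    alternatingSum M f - alternatingSum M (λ i → f (suc i))
      ≡⟨ solve 2 (λ a b → a :- b := :- (b :- a)) refl (alternatingSum M f) (alternatingSum M (λ i → f (suc i))) ⟩
    - (alternatingSum M (λ i → f (suc i)) - alternatingSum M f)
      ≡⟨ cong -_ (alternatingSum-linear M _ f) ⟨
    - alternatingSum M (Δ f)
      ≡⟨ cong -_ (alternatingSum-vanishes M (Δ f) df) ⟩
    - 0ℚ
      ≡⟨⟩
    0ℚ ∎
    where open ≡-Reasoning

module GeneralisedBinomial where
  open import Data.Rational using (_+_; _*_; _-_; -_)
  open import Data.Rational.Solver using (module +-*-Solver)
  open +-*-Solver
  open ℚ-Arithmetic
  open FiniteDifference

  binomQ-suc : ∀ x k → ℕ→ℚ (suc k) * binomQ x (suc k) ≡ binomQ x k * (x - ℕ→ℚ k)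
  binomQ-suc x k = begin
    K * (binomQ x k * ((x - ℕ→ℚ k) * recip (suc k)))
      ≡⟨ solve 4 (λ K b d r → K :* (b :* (d :* r)) := (b :* d) :* (K :* r)) refl K (binomQ x k) (x - ℕ→ℚ k) (recip (suc k)) ⟩
    (binomQ x k * (x - ℕ→ℚ k)) * (K * recip (suc k))
      ≡⟨ cong (binomQ x k * (x - ℕ→ℚ k) *_) (*-recip (suc k)) ⟩
    (binomQ x k * (x - ℕ→ℚ k)) * 1ℚ
      ≡⟨ ℚ.*-identityʳ _ ⟩
    binomQ x k * (x - ℕ→ℚ k) ∎
    where
    open ≡-Reasoning
    K : ℚ
    K = ℕ→ℚ (suc k)

  binomQ-pascal : ∀ x j → binomQ (x + 1ℚ) (suc j) ≡ binomQ x (suc j) + binomQ x j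
  binomQ-pascal x zero = solve 1 (λ x → con 1ℚ :* (((x :+ con 1ℚ) :- con 0ℚ) :* con 1ℚ)
                                       := con 1ℚ :* ((x :- con 0ℚ) :* con 1ℚ) :+ con 1ℚ) refl x
  binomQ-pascal x (suc j) = ℕ→ℚ-*-cancelˡ (suc (suc j)) (begin
    ℕ→ℚ (suc (suc j)) * binomQ (x + 1ℚ) (suc (suc j))
      ≡⟨ binomQ-suc (x + 1ℚ) (suc j) ⟩
    binomQ (x + 1ℚ) (suc j) * (x + 1ℚ - ℕ→ℚ (suc j))
      ≡⟨ cong₂ (λ b J → b * (x + 1ℚ - J)) (binomQ-pascal x j) (ℕ→ℚ-suc j) ⟩
    (B₁ + B₀) * (x + 1ℚ - (1ℚ + J))
      ≡⟨ solve 4 (λ x J B₁ B₀ → (B₁ :+ B₀) :* (x :+ con 1ℚ :- (con 1ℚ :+ J)) := B₁ :* (x :- J) :+ B₀ :* (x :- J))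
                 refl x J B₁ B₀ ⟩
    B₁ * (x - J) + B₀ * (x - J)
      ≡⟨ cong (B₁ * (x - J) +_) (trans (sym (binomQ-suc x j)) (cong (_* B₁) (ℕ→ℚ-suc j))) ⟩
    B₁ * (x - J) + (1ℚ + J) * B₁
      ≡⟨ solve 3 (λ x J B₁ → B₁ :* (x :- J) :+ (con 1ℚ :+ J) :* B₁
                           := B₁ :* (x :- (con 1ℚ :+ J)) :+ (con 1ℚ :+ (con 1ℚ :+ J)) :* B₁)
                 refl x J B₁ ⟩
    B₁ * (x - (1ℚ + J)) + (1ℚ + (1ℚ + J)) * B₁
      ≡⟨ cong₂ (λ J′ J″ → B₁ * (x - J′) + J″ * B₁) (ℕ→ℚ-suc j) (trans (ℕ→ℚ-suc (suc j)) (cong (1ℚ +_) (ℕ→ℚ-suc j))) ⟨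
    B₁ * (x - ℕ→ℚ (suc j)) + ℕ→ℚ (suc (suc j)) * B₁
      ≡⟨ cong (_+ ℕ→ℚ (suc (suc j)) * B₁) (binomQ-suc x (suc j)) ⟨
    ℕ→ℚ (suc (suc j)) * binomQ x (suc (suc j)) + ℕ→ℚ (suc (suc j)) * B₁
      ≡⟨ ℚ.*-distribˡ-+ (ℕ→ℚ (suc (suc j))) _ _ ⟨
    ℕ→ℚ (suc (suc j)) * (binomQ x (suc (suc j)) + binomQ x (suc j)) ∎)
    where
    open ≡-Reasoning
    J B₀ B₁ : ℚ
    J = ℕ→ℚ j
    B₀ = binomQ x j
    B₁ = binomQ x (suc j)

  binomQ-absorb : ∀ x k → ℕ→ℚ (suc k) * binomQ (x + 1ℚ) (suc k) ≡ (x + 1ℚ) * binomQ x k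
  binomQ-absorb x zero = solve 1 (λ x → con 1ℚ :* (con 1ℚ :* (((x :+ con 1ℚ) :- con 0ℚ) :* con 1ℚ)) := (x :+ con 1ℚ) :* con 1ℚ) refl x
  binomQ-absorb x (suc k) = ℕ→ℚ-*-cancelˡ (suc k) (begin
    K * (ℕ→ℚ (suc (suc k)) * binomQ (x + 1ℚ) (suc (suc k)))
      ≡⟨ cong (K *_) (binomQ-suc (x + 1ℚ) (suc k)) ⟩
    K * (binomQ (x + 1ℚ) (suc k) * (x + 1ℚ - K))
      ≡⟨ ℚ.*-assoc K _ _ ⟨
    (K * binomQ (x + 1ℚ) (suc k)) * (x + 1ℚ - K)
      ≡⟨ cong₂ (λ b K′ → b * (x + 1ℚ - K′)) (binomQ-absorb x k) (ℕ→ℚ-suc k) ⟩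
    ((x + 1ℚ) * binomQ x k) * (x + 1ℚ - (1ℚ + ℕ→ℚ k))
      ≡⟨ solve 3 (λ x b k → ((x :+ con 1ℚ) :* b) :* (x :+ con 1ℚ :- (con 1ℚ :+ k)) := (x :+ con 1ℚ) :* (b :* (x :- k)))
                 refl x (binomQ x k) (ℕ→ℚ k) ⟩
    (x + 1ℚ) * (binomQ x k * (x - ℕ→ℚ k))
      ≡⟨ cong ((x + 1ℚ) *_) (binomQ-suc x k) ⟨
    (x + 1ℚ) * (K * binomQ x (suc k))
      ≡⟨ solve 3 (λ a K b → a :* (K :* b) := K :* (a :* b)) refl (x + 1ℚ) K (binomQ x (suc k)) ⟩
    K * ((x + 1ℚ) * binomQ x (suc k)) ∎)
    where
    open ≡-Reasoning
    K : ℚ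
    K = ℕ→ℚ (suc k)

  binomQ-degree : ∀ x y j → DegreeBelow (suc j) (λ i → binomQ (x + ℕ→ℚ i * y) j)
  binomQ-degree x y zero i = refl
  binomQ-degree x y (suc j) =
    degreeBelow-cong (suc (suc j)) linear-factor
      (degreeBelow-*-linear (suc j) ((x - ℕ→ℚ j) * r) (y * r) (λ i → binomQ (x + ℕ→ℚ i * y) j) (binomQ-degree x y j))
    where
    r : ℚ
    r = recip (suc j)
    linear-factor : ∀ i → binomQ (x + ℕ→ℚ i * y) j * ((x - ℕ→ℚ j) * r + ℕ→ℚ i * (y * r))
                        ≡ binomQ (x + ℕ→ℚ i * y) (suc j)
    linear-factor i = cong (binomQ (x + ℕ→ℚ i * y) j *_)
      (solve 5 (λ x y i j r → (x :- j) :* r :+ i :* (y :* r) := ((x :+ i :* y) :- j) :* r) refl x y (ℕ→ℚ i) (ℕ→ℚ j) r)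

  binomQ-upper-negation : ∀ k j → binomQ (ℕ→ℚ j - 1ℚ - ℕ→ℚ k) j ≡ sign j * ℕ→ℚ (k C j)
  binomQ-upper-negation k zero = refl
  binomQ-upper-negation zero (suc j) = begin
    binomQ (ℕ→ℚ (suc j) - 1ℚ - 0ℚ) (suc j)
      ≡⟨ cong (λ J → binomQ (J - 1ℚ - 0ℚ) (suc j)) (ℕ→ℚ-suc j) ⟩
    binomQ (1ℚ + J - 1ℚ - 0ℚ) (suc j)
      ≡⟨ cong (λ x → binomQ x (suc j)) (solve 1 (λ J → con 1ℚ :+ J :- con 1ℚ :- con 0ℚ := J) refl J) ⟩
    binomQ J j * ((J - J) * recip (suc j))
      ≡⟨ solve 3 (λ b J r → b :* ((J :- J) :* r) := con 0ℚ) refl (binomQ J j) J (recip (suc j)) ⟩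
    0ℚ
      ≡⟨ ℚ.*-zeroʳ (sign (suc j)) ⟨
    sign (suc j) * ℕ→ℚ (0 C suc j) ∎
    where
    open ≡-Reasoning
    J : ℚ
    J = ℕ→ℚ j
  binomQ-upper-negation (suc k) (suc j) = begin
    binomQ (ℕ→ℚ (suc j) - 1ℚ - ℕ→ℚ (suc k)) (suc j)
      ≡⟨ cong (λ x → binomQ x (suc j)) y≡ ⟩
    binomQ y (suc j)
      ≡⟨ solve 2 (λ a b → a := (a :+ b) :- b) refl (binomQ y (suc j)) (binomQ y j) ⟩
    (binomQ y (suc j) + binomQ y j) - binomQ y j
      ≡⟨ cong (_- binomQ y j) (binomQ-pascal y j) ⟨
    binomQ (y + 1ℚ) (suc j) - binomQ y j
      ≡⟨ cong (λ x → binomQ x (suc j) - binomQ y j) y+1≡ ⟩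
    binomQ (ℕ→ℚ (suc j) - 1ℚ - ℕ→ℚ k) (suc j) - binomQ y j
      ≡⟨ cong₂ _-_ (binomQ-upper-negation k (suc j)) (binomQ-upper-negation k j) ⟩
    - sign j * ℕ→ℚ (k C suc j) - sign j * ℕ→ℚ (k C j)
      ≡⟨ solve 3 (λ s a b → (:- s) :* a :- s :* b := (:- s) :* (b :+ a)) refl (sign j) (ℕ→ℚ (k C suc j)) (ℕ→ℚ (k C j)) ⟩
    - sign j * (ℕ→ℚ (k C j) + ℕ→ℚ (k C suc j))
      ≡⟨ cong (- sign j *_) (trans (sym (ℕ→ℚ-+ (k C j) (k C suc j))) (cong ℕ→ℚ (nCk+nC[k+1]≡[n+1]C[k+1] k j))) ⟩
    - sign j * ℕ→ℚ (suc k C suc j) ∎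
    where
    open ≡-Reasoning
    y : ℚ
    y = ℕ→ℚ j - 1ℚ - ℕ→ℚ k
    y≡ : ℕ→ℚ (suc j) - 1ℚ - ℕ→ℚ (suc k) ≡ y
    y≡ = begin
      ℕ→ℚ (suc j) - 1ℚ - ℕ→ℚ (suc k)
        ≡⟨ cong₂ (λ J K → J - 1ℚ - K) (ℕ→ℚ-suc j) (ℕ→ℚ-suc k) ⟩
      (1ℚ + ℕ→ℚ j) - 1ℚ - (1ℚ + ℕ→ℚ k)
        ≡⟨ solve 2 (λ J K → (con 1ℚ :+ J) :- con 1ℚ :- (con 1ℚ :+ K) := J :- con 1ℚ :- K) refl (ℕ→ℚ j) (ℕ→ℚ k) ⟩
      y ∎
    y+1≡ : y + 1ℚ ≡ ℕ→ℚ (suc j) - 1ℚ - ℕ→ℚ k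
    y+1≡ = begin
      y + 1ℚ
        ≡⟨ solve 2 (λ J K → J :- con 1ℚ :- K :+ con 1ℚ := (con 1ℚ :+ J) :- con 1ℚ :- K) refl (ℕ→ℚ j) (ℕ→ℚ k) ⟩
      (1ℚ + ℕ→ℚ j) - 1ℚ - ℕ→ℚ k
        ≡⟨ cong (λ J → J - 1ℚ - ℕ→ℚ k) (ℕ→ℚ-suc j) ⟨
      ℕ→ℚ (suc j) - 1ℚ - ℕ→ℚ k ∎

module HalfIntegerBinomial where
  open import Data.Rational using (_+_; _*_; _-_; -_)
  open import Data.Rational.Solver using (module +-*-Solver)
  open +-*-Solver
  open ℚ-Arithmetic
  open GeneralisedBinomial
  open BinomialCoefficient using (C-central-step; stepFactor; stepFactor-*-C-odd)
  open Indices using (2[t+1]+1≡2+[2t+1]; 2[t+1]+1≡2t+3)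

  centralFactor : ℕ → ℚ
  centralFactor ν = recip (2 ℕ.^ (2 ℕ.* ν ℕ.+ 1)) * ℕ→ℚ ((2 ℕ.* ν ℕ.+ 1) C (ν ℕ.+ 1))

  ℕ→ℚ-*³ : ∀ a b c → ℕ→ℚ (a ℕ.* b ℕ.* c) ≡ ℕ→ℚ a * ℕ→ℚ b * ℕ→ℚ c
  ℕ→ℚ-*³ a b c = trans (ℕ→ℚ-* (a ℕ.* b) c) (cong (_* ℕ→ℚ c) (ℕ→ℚ-* a b))

  centralFactor-suc : ∀ t → ℕ→ℚ (suc t) * (centralFactor (suc t) * ℕ→ℚ (2 ℕ.* suc t ℕ.+ 2))
                          ≡ (½ + ℕ→ℚ t + 1ℚ) * (centralFactor t * ℕ→ℚ (2 ℕ.* t ℕ.+ 2))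
  centralFactor-suc t = begin
    ℕ→ℚ (suc t) * ((r′ * b′) * ℕ→ℚ (2 ℕ.* suc t ℕ.+ 2))
      ≡⟨ cong₂ (λ u v → u * ((r′ * b′) * v)) (trans (ℕ→ℚ-suc t) (ℚ.+-comm 1ℚ T))
               (trans (ℕ→ℚ-affine 2 (suc t) 2) (cong (λ s → ℕ→ℚ 2 * s + ℕ→ℚ 2) (ℕ→ℚ-suc t))) ⟩
    (T + 1ℚ) * ((r′ * b′) * (ℕ→ℚ 2 * (1ℚ + T) + ℕ→ℚ 2))
      ≡⟨ solve 3 (λ T r b → (T :+ con 1ℚ) :* ((r :* b) :* (con (ℕ→ℚ 2) :* (con 1ℚ :+ T) :+ con (ℕ→ℚ 2)))
                          := con (ℕ→ℚ 2) :* r :* ((T :+ con 1ℚ) :* (T :+ con (ℕ→ℚ 2)) :* b)) refl T r′ b′ ⟩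
    ℕ→ℚ 2 * r′ * ((T + 1ℚ) * (T + ℕ→ℚ 2) * b′)
      ≡⟨ cong (ℕ→ℚ 2 * r′ *_) central ⟩
    ℕ→ℚ 2 * r′ * ((ℕ→ℚ 2 * T + ℕ→ℚ 3) * (ℕ→ℚ 2 * T + ℕ→ℚ 2) * b)
      ≡⟨ solve 3 (λ T r b → con (ℕ→ℚ 2) :* r :* ((con (ℕ→ℚ 2) :* T :+ con (ℕ→ℚ 3)) :* (con (ℕ→ℚ 2) :* T :+ con (ℕ→ℚ 2)) :* b)
                          := (con ½ :+ T :+ con 1ℚ) :* ((con (ℕ→ℚ 4) :* r) :* b :* (con (ℕ→ℚ 2) :* T :+ con (ℕ→ℚ 2)))) refl T r′ b ⟩
    (½ + T + 1ℚ) * ((ℕ→ℚ 4 * r′) * b * (ℕ→ℚ 2 * T + ℕ→ℚ 2))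
      ≡⟨ cong₂ (λ u v → (½ + T + 1ℚ) * (u * b * v)) (sym 4r′≡r) (ℕ→ℚ-affine 2 t 2) ⟨
    (½ + T + 1ℚ) * ((r * b) * ℕ→ℚ (2 ℕ.* t ℕ.+ 2)) ∎
    where
    open ≡-Reasoning
    T r r′ b b′ : ℚ
    T  = ℕ→ℚ t
    r  = recip (2 ℕ.^ (2 ℕ.* t ℕ.+ 1))
    r′ = recip (2 ℕ.^ (2 ℕ.* suc t ℕ.+ 1))
    b  = ℕ→ℚ ((2 ℕ.* t ℕ.+ 1) C (t ℕ.+ 1))
    b′ = ℕ→ℚ ((2 ℕ.* suc t ℕ.+ 1) C (suc t ℕ.+ 1))
    4r′≡r : ℕ→ℚ 4 * r′ ≡ r
    4r′≡r = begin
      ℕ→ℚ 4 * r′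
        ≡⟨ cong (λ e → ℕ→ℚ 4 * recip (2 ℕ.^ e)) (2[t+1]+1≡2+[2t+1] t) ⟩
      ℕ→ℚ 4 * recip (2 ℕ.^ (2 ℕ.+ (2 ℕ.* t ℕ.+ 1)))
        ≡⟨ cong (λ p → ℕ→ℚ 4 * recip p) (ℕ.^-distribˡ-+-* 2 2 (2 ℕ.* t ℕ.+ 1)) ⟩
      ℕ→ℚ 4 * recip (4 ℕ.* 2 ℕ.^ (2 ℕ.* t ℕ.+ 1))
        ≡⟨ *-recip-* 4 (2 ℕ.^ (2 ℕ.* t ℕ.+ 1)) ⟩
      r ∎
      where
      instance
        2^-nonZero : NonZero (2 ℕ.^ (2 ℕ.* t ℕ.+ 1))
        2^-nonZero = ℕ.m^n≢0 2 (2 ℕ.* t ℕ.+ 1)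
    central : (T + 1ℚ) * (T + ℕ→ℚ 2) * b′ ≡ (ℕ→ℚ 2 * T + ℕ→ℚ 3) * (ℕ→ℚ 2 * T + ℕ→ℚ 2) * b
    central = begin
      (T + 1ℚ) * (T + ℕ→ℚ 2) * b′
        ≡⟨ cong₂ (λ u v → u * v * b′) (ℕ→ℚ-+ t 1) (ℕ→ℚ-+ t 2) ⟨
      ℕ→ℚ (t ℕ.+ 1) * ℕ→ℚ (t ℕ.+ 2) * ℕ→ℚ ((2 ℕ.* suc t ℕ.+ 1) C (suc t ℕ.+ 1))
        ≡⟨ cong₂ (λ n k → ℕ→ℚ (t ℕ.+ 1) * ℕ→ℚ (t ℕ.+ 2) * ℕ→ℚ (n C k)) (2[t+1]+1≡2t+3 t) (sym (ℕ.+-suc t 1)) ⟩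
      ℕ→ℚ (t ℕ.+ 1) * ℕ→ℚ (t ℕ.+ 2) * ℕ→ℚ ((2 ℕ.* t ℕ.+ 3) C (t ℕ.+ 2))
        ≡⟨ ℕ→ℚ-*³ (t ℕ.+ 1) (t ℕ.+ 2) _ ⟨
      ℕ→ℚ ((t ℕ.+ 1) ℕ.* (t ℕ.+ 2) ℕ.* ((2 ℕ.* t ℕ.+ 3) C (t ℕ.+ 2)))
        ≡⟨ cong ℕ→ℚ (C-central-step t) ⟩
      ℕ→ℚ ((2 ℕ.* t ℕ.+ 3) ℕ.* (2 ℕ.* t ℕ.+ 2) ℕ.* ((2 ℕ.* t ℕ.+ 1) C (t ℕ.+ 1)))
        ≡⟨ ℕ→ℚ-*³ (2 ℕ.* t ℕ.+ 3) (2 ℕ.* t ℕ.+ 2) _ ⟩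
      ℕ→ℚ (2 ℕ.* t ℕ.+ 3) * ℕ→ℚ (2 ℕ.* t ℕ.+ 2) * b
        ≡⟨ cong₂ (λ u v → u * v * b) (ℕ→ℚ-affine 2 t 3) (ℕ→ℚ-affine 2 t 2) ⟩
      (ℕ→ℚ 2 * T + ℕ→ℚ 3) * (ℕ→ℚ 2 * T + ℕ→ℚ 2) * b ∎


  binomQ-half-central : ∀ t → binomQ (½ + ℕ→ℚ t) t ≡ centralFactor t * ℕ→ℚ (2 ℕ.* t ℕ.+ 2)
  binomQ-half-central zero    = refl
  binomQ-half-central (suc t) = ℕ→ℚ-*-cancelˡ (suc t) (begin
    ℕ→ℚ (suc t) * binomQ (½ + ℕ→ℚ (suc t)) (suc t)     ≡⟨ cong (λ x → ℕ→ℚ (suc t) * binomQ x (suc t)) ½+t+1 ⟩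
    ℕ→ℚ (suc t) * binomQ (½ + ℕ→ℚ t + 1ℚ) (suc t)      ≡⟨ binomQ-absorb (½ + ℕ→ℚ t) t ⟩
    (½ + ℕ→ℚ t + 1ℚ) * binomQ (½ + ℕ→ℚ t) t           ≡⟨ cong ((½ + ℕ→ℚ t + 1ℚ) *_) (binomQ-half-central t) ⟩
    (½ + ℕ→ℚ t + 1ℚ) * (centralFactor t * ℕ→ℚ (2 ℕ.* t ℕ.+ 2)) ≡⟨ centralFactor-suc t ⟨
    ℕ→ℚ (suc t) * (centralFactor (suc t) * ℕ→ℚ (2 ℕ.* suc t ℕ.+ 2)) ∎)
    where
    open ≡-Reasoning
    ½+t+1 : ½ + ℕ→ℚ (suc t) ≡ ½ + ℕ→ℚ t + 1ℚ
    ½+t+1 = trans (cong (½ +_) (ℕ→ℚ-suc t)) (solve 1 (λ t → con ½ :+ (con 1ℚ :+ t) := con ½ :+ t :+ con 1ℚ) refl (ℕ→ℚ t))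

  halfBinomialProduct : ℕ → ℕ → ℚ
  halfBinomialProduct ν μ = binomQ (½ + ℕ→ℚ ν) (ν ∸ μ) * binomQ (½ + ℕ→ℚ ν) μ

  halfBinomialProduct-step : ∀ μ t → ℕ→ℚ (stepFactor μ) * halfBinomialProduct (suc μ ℕ.+ t) (suc μ)
                                   ≡ ℕ→ℚ (stepFactor t) * halfBinomialProduct (suc μ ℕ.+ t) μ
  halfBinomialProduct-step μ t = begin
    ℕ→ℚ (stepFactor μ) * (binomQ h (ν ∸ suc μ) * binomQ h (suc μ))
      ≡⟨ cong₂ (λ u i → u * (binomQ h i * binomQ h (suc μ))) (stepFactor≡ μ) (ℕ.m+n∸m≡n (suc μ) t) ⟩
    (ℕ→ℚ 2 * (1ℚ + M)) * (ℕ→ℚ 2 * M + ℕ→ℚ 3) * (Bₜ * binomQ h (suc μ))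
      ≡⟨ solve 3 (λ M a b → (con (ℕ→ℚ 2) :* (con 1ℚ :+ M)) :* (con (ℕ→ℚ 2) :* M :+ con (ℕ→ℚ 3)) :* (a :* b)
                          := con (ℕ→ℚ 2) :* (con (ℕ→ℚ 2) :* M :+ con (ℕ→ℚ 3)) :* a :* ((con 1ℚ :+ M) :* b))
                 refl M Bₜ (binomQ h (suc μ)) ⟩
    ℕ→ℚ 2 * (ℕ→ℚ 2 * M + ℕ→ℚ 3) * Bₜ * ((1ℚ + M) * binomQ h (suc μ))
      ≡⟨ cong (λ x → ℕ→ℚ 2 * (ℕ→ℚ 2 * M + ℕ→ℚ 3) * Bₜ * x) (trans (cong (_* binomQ h (suc μ)) (sym (ℕ→ℚ-suc μ))) (binomQ-suc h μ)) ⟩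
    ℕ→ℚ 2 * (ℕ→ℚ 2 * M + ℕ→ℚ 3) * Bₜ * (B_μ * (h - M))
      ≡⟨ cong (λ x → ℕ→ℚ 2 * (ℕ→ℚ 2 * M + ℕ→ℚ 3) * Bₜ * (B_μ * (x - M))) h≡ ⟩
    ℕ→ℚ 2 * (ℕ→ℚ 2 * M + ℕ→ℚ 3) * Bₜ * (B_μ * ((½ + (1ℚ + M + T)) - M))
      ≡⟨ solve 4 (λ M T a b → con (ℕ→ℚ 2) :* (con (ℕ→ℚ 2) :* M :+ con (ℕ→ℚ 3)) :* a :* (b :* ((con ½ :+ (con 1ℚ :+ M :+ T)) :- M))
                            := con (ℕ→ℚ 2) :* (con (ℕ→ℚ 2) :* T :+ con (ℕ→ℚ 3)) :* (a :* ((con ½ :+ (con 1ℚ :+ M :+ T)) :- T)) :* b)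
                 refl M T Bₜ B_μ ⟩
    ℕ→ℚ 2 * (ℕ→ℚ 2 * T + ℕ→ℚ 3) * (Bₜ * ((½ + (1ℚ + M + T)) - T)) * B_μ
      ≡⟨ cong (λ x → ℕ→ℚ 2 * (ℕ→ℚ 2 * T + ℕ→ℚ 3) * (Bₜ * (x - T)) * B_μ) h≡ ⟨
    ℕ→ℚ 2 * (ℕ→ℚ 2 * T + ℕ→ℚ 3) * (Bₜ * (h - T)) * B_μ
      ≡⟨ cong (λ x → ℕ→ℚ 2 * (ℕ→ℚ 2 * T + ℕ→ℚ 3) * x * B_μ) (trans (sym (binomQ-suc h t)) (cong (_* binomQ h (suc t)) (ℕ→ℚ-suc t))) ⟩
    ℕ→ℚ 2 * (ℕ→ℚ 2 * T + ℕ→ℚ 3) * ((1ℚ + T) * binomQ h (suc t)) * B_μ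
      ≡⟨ solve 3 (λ T a b → con (ℕ→ℚ 2) :* (con (ℕ→ℚ 2) :* T :+ con (ℕ→ℚ 3)) :* ((con 1ℚ :+ T) :* a) :* b
                          := (con (ℕ→ℚ 2) :* (con 1ℚ :+ T)) :* (con (ℕ→ℚ 2) :* T :+ con (ℕ→ℚ 3)) :* (a :* b))
                 refl T (binomQ h (suc t)) B_μ ⟩
    (ℕ→ℚ 2 * (1ℚ + T)) * (ℕ→ℚ 2 * T + ℕ→ℚ 3) * (binomQ h (suc t) * binomQ h μ)
      ≡⟨ cong₂ (λ u i → u * (binomQ h i * binomQ h μ)) (stepFactor≡ t) ν∸μ≡ ⟨
    ℕ→ℚ (stepFactor t) * (binomQ h (ν ∸ μ) * binomQ h μ) ∎
    where
    open ≡-Reasoning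
    ν : ℕ
    ν = suc μ ℕ.+ t
    h M T Bₜ B_μ : ℚ
    h = ½ + ℕ→ℚ ν
    M = ℕ→ℚ μ
    T = ℕ→ℚ t
    Bₜ = binomQ h t
    B_μ = binomQ h μ
    h≡ : h ≡ ½ + (1ℚ + M + T)
    h≡ = cong (½ +_) (trans (ℕ→ℚ-+ (suc μ) t) (cong (_+ T) (ℕ→ℚ-suc μ)))
    ν∸μ≡ : ν ∸ μ ≡ suc t
    ν∸μ≡ = trans (cong (_∸ μ) (sym (ℕ.+-suc μ t))) (ℕ.m+n∸m≡n μ (suc t))
    stepFactor≡ : ∀ k → ℕ→ℚ (stepFactor k) ≡ (ℕ→ℚ 2 * (1ℚ + ℕ→ℚ k)) * (ℕ→ℚ 2 * ℕ→ℚ k + ℕ→ℚ 3)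
    stepFactor≡ k = begin
      ℕ→ℚ ((2 ℕ.+ 2 ℕ.* k) ℕ.* (3 ℕ.+ 2 ℕ.* k))  ≡⟨ ℕ→ℚ-* (2 ℕ.+ 2 ℕ.* k) (3 ℕ.+ 2 ℕ.* k) ⟩
      ℕ→ℚ (2 ℕ.+ 2 ℕ.* k) * ℕ→ℚ (3 ℕ.+ 2 ℕ.* k) ≡⟨ cong₂ _*_ (trans (ℕ→ℚ-+ 2 (2 ℕ.* k)) (cong (ℕ→ℚ 2 +_) (ℕ→ℚ-* 2 k)))
                                                          (trans (ℕ→ℚ-+ 3 (2 ℕ.* k)) (cong (ℕ→ℚ 3 +_) (ℕ→ℚ-* 2 k))) ⟩
      (ℕ→ℚ 2 + ℕ→ℚ 2 * K) * (ℕ→ℚ 3 + ℕ→ℚ 2 * K)  ≡⟨ solve 1 (λ K → (con (ℕ→ℚ 2) :+ con (ℕ→ℚ 2) :* K) :* (con (ℕ→ℚ 3) :+ con (ℕ→ℚ 2) :* K)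
                                                           := (con (ℕ→ℚ 2) :* (con 1ℚ :+ K)) :* (con (ℕ→ℚ 2) :* K :+ con (ℕ→ℚ 3))) refl K ⟩
      (ℕ→ℚ 2 * (1ℚ + K)) * (ℕ→ℚ 2 * K + ℕ→ℚ 3) ∎
      where
      K : ℚ
      K = ℕ→ℚ k

  halfBinomialProduct≡ : ∀ ν μ → μ ≤ ν →
    halfBinomialProduct ν μ ≡ centralFactor ν * ℕ→ℚ ((2 ℕ.* ν ℕ.+ 2) C (2 ℕ.* μ ℕ.+ 1))
  halfBinomialProduct≡ ν μ μ≤ν =
    subst (λ ν′ → halfBinomialProduct ν′ μ ≡ G ν′ μ) (ℕ.m+[n∸m]≡n μ≤ν) (shifted μ (ν ∸ μ))
    where
    G : ℕ → ℕ → ℚ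
    G ν μ = centralFactor ν * ℕ→ℚ ((2 ℕ.* ν ℕ.+ 2) C (2 ℕ.* μ ℕ.+ 1))
    G-step : ∀ μ t → ℕ→ℚ (stepFactor μ) * G (suc μ ℕ.+ t) (suc μ) ≡ ℕ→ℚ (stepFactor t) * G (suc μ ℕ.+ t) μ
    G-step μ t = begin
      ℕ→ℚ (stepFactor μ) * (c * ℕ→ℚ (L C (2 ℕ.* suc μ ℕ.+ 1)))
        ≡⟨ solve 3 (λ a c x → a :* (c :* x) := c :* (a :* x)) refl (ℕ→ℚ (stepFactor μ)) c (ℕ→ℚ (L C (2 ℕ.* suc μ ℕ.+ 1))) ⟩
      c * (ℕ→ℚ (stepFactor μ) * ℕ→ℚ (L C (2 ℕ.* suc μ ℕ.+ 1)))
        ≡⟨ cong (c *_) lifted ⟩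
      c * (ℕ→ℚ (stepFactor t) * ℕ→ℚ (L C (2 ℕ.* μ ℕ.+ 1)))
        ≡⟨ solve 3 (λ a c x → c :* (a :* x) := a :* (c :* x)) refl (ℕ→ℚ (stepFactor t)) c (ℕ→ℚ (L C (2 ℕ.* μ ℕ.+ 1))) ⟩
      ℕ→ℚ (stepFactor t) * (c * ℕ→ℚ (L C (2 ℕ.* μ ℕ.+ 1))) ∎
      where
      open ≡-Reasoning
      L : ℕ
      L = 2 ℕ.* (suc μ ℕ.+ t) ℕ.+ 2
      c : ℚ
      c = centralFactor (suc μ ℕ.+ t)
      lifted : ℕ→ℚ (stepFactor μ) * ℕ→ℚ (L C (2 ℕ.* suc μ ℕ.+ 1)) ≡ ℕ→ℚ (stepFactor t) * ℕ→ℚ (L C (2 ℕ.* μ ℕ.+ 1))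
      lifted = begin
        ℕ→ℚ (stepFactor μ) * ℕ→ℚ (L C (2 ℕ.* suc μ ℕ.+ 1)) ≡⟨ ℕ→ℚ-* (stepFactor μ) (L C (2 ℕ.* suc μ ℕ.+ 1)) ⟨
        ℕ→ℚ (stepFactor μ ℕ.* (L C (2 ℕ.* suc μ ℕ.+ 1)))     ≡⟨ cong ℕ→ℚ (stepFactor-*-C-odd μ t) ⟩
        ℕ→ℚ (stepFactor t ℕ.* (L C (2 ℕ.* μ ℕ.+ 1)))         ≡⟨ ℕ→ℚ-* (stepFactor t) (L C (2 ℕ.* μ ℕ.+ 1)) ⟩
        ℕ→ℚ (stepFactor t) * ℕ→ℚ (L C (2 ℕ.* μ ℕ.+ 1))     ∎
    shifted : ∀ μ t → halfBinomialProduct (μ ℕ.+ t) μ ≡ G (μ ℕ.+ t) μ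
    shifted zero t = begin
      binomQ (½ + ℕ→ℚ t) t * 1ℚ
        ≡⟨ ℚ.*-identityʳ (binomQ (½ + ℕ→ℚ t) t) ⟩
      binomQ (½ + ℕ→ℚ t) t
        ≡⟨ binomQ-half-central t ⟩
      centralFactor t * ℕ→ℚ (2 ℕ.* t ℕ.+ 2)
        ≡⟨ cong (λ x → centralFactor t * ℕ→ℚ x) (nC1≡n (2 ℕ.* t ℕ.+ 2)) ⟨
      G t 0 ∎
      where open ≡-Reasoning
    shifted (suc μ) t = ℕ→ℚ-*-cancelˡ (stepFactor μ) (begin
      ℕ→ℚ (stepFactor μ) * halfBinomialProduct ν′ (suc μ)
        ≡⟨ halfBinomialProduct-step μ t ⟩
      ℕ→ℚ (stepFactor t) * halfBinomialProduct ν′ μ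
        ≡⟨ cong (ℕ→ℚ (stepFactor t) *_) (subst (λ ν′ → halfBinomialProduct ν′ μ ≡ G ν′ μ) (ℕ.+-suc μ t) (shifted μ (suc t))) ⟩
      ℕ→ℚ (stepFactor t) * G ν′ μ
        ≡⟨ G-step μ t ⟨
      ℕ→ℚ (stepFactor μ) * G ν′ (suc μ) ∎)
      where
      open ≡-Reasoning
      ν′ : ℕ
      ν′ = suc μ ℕ.+ t

module ParityIdentity where
  open import Data.Rational using (_+_; _*_; _-_; -_)
  open import Data.Rational.Solver using (module +-*-Solver)
  open +-*-Solver
  open ℚ-Arithmetic
  open ℚ-Sum using (sum-cong; sum-cong-≤; *-distribˡ-sum; sum-trailing-zeros; sum-parity; sum-homo)
  open FiniteDifference
  open GeneralisedBinomial

  neg-^ℚ : ∀ x j → (- x) ^ℚ j ≡ sign j * x ^ℚ j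
  neg-^ℚ x zero    = sym (ℚ.*-identityˡ 1ℚ)
  neg-^ℚ x (suc j) = begin
    - x * (- x) ^ℚ j
      ≡⟨ cong (- x *_) (neg-^ℚ x j) ⟩
    - x * (sign j * x ^ℚ j)
      ≡⟨ solve 3 (λ x s p → (:- x) :* (s :* p) := (:- s) :* (x :* p)) refl x (sign j) (x ^ℚ j) ⟩
    - sign j * x ^ℚ suc j ∎
    where open ≡-Reasoning

  binomial-expansion-padded : ∀ d k M X →
    sumTo (d ℕ.+ k) (λ j → sign j * ℕ→ℚ (k C j) * (X ^ℚ j * M ^ℚ ((d ℕ.+ k) ∸ j))) ≡ M ^ℚ d * (M - X) ^ℚ k
  binomial-expansion-padded d k M X = begin
    sumTo (d ℕ.+ k) t
      ≡⟨ sum-trailing-zeros d k t t-vanishes ⟩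
    sumTo k t
      ≡⟨ sum-cong-≤ k rearrange ⟩
    sumTo k (λ j → M ^ℚ d * (ℕ→ℚ (k C j) * ((- X) ^ℚ j * M ^ℚ (k ∸ j))))
      ≡⟨ *-distribˡ-sum (M ^ℚ d) k _ ⟨
    M ^ℚ d * sumTo k (λ j → ℕ→ℚ (k C j) * ((- X) ^ℚ j * M ^ℚ (k ∸ j)))
      ≡⟨ cong (M ^ℚ d *_) (binomial-theorem-ℚ (- X) M k) ⟨
    M ^ℚ d * (- X + M) ^ℚ k
      ≡⟨ cong (λ y → M ^ℚ d * y ^ℚ k) (ℚ.+-comm (- X) M) ⟩
    M ^ℚ d * (M - X) ^ℚ k ∎
    where
    open ≡-Reasoning
    t : ℕ → ℚ
    t j = sign j * ℕ→ℚ (k C j) * (X ^ℚ j * M ^ℚ ((d ℕ.+ k) ∸ j))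
    t-vanishes : ∀ j → k < j → t j ≡ 0ℚ
    t-vanishes j k<j = begin
      sign j * ℕ→ℚ (k C j) * (X ^ℚ j * M ^ℚ ((d ℕ.+ k) ∸ j))
        ≡⟨ cong (λ c → sign j * ℕ→ℚ c * (X ^ℚ j * M ^ℚ ((d ℕ.+ k) ∸ j))) (k>n⇒nCk≡0 k<j) ⟩
      sign j * 0ℚ * (X ^ℚ j * M ^ℚ ((d ℕ.+ k) ∸ j))
        ≡⟨ solve 2 (λ s y → s :* con 0ℚ :* y := con 0ℚ) refl (sign j) (X ^ℚ j * M ^ℚ ((d ℕ.+ k) ∸ j)) ⟩
      0ℚ ∎
    rearrange : ∀ j → j ≤ k → t j ≡ M ^ℚ d * (ℕ→ℚ (k C j) * ((- X) ^ℚ j * M ^ℚ (k ∸ j)))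
    rearrange j j≤k = begin
      sign j * ℕ→ℚ (k C j) * (X ^ℚ j * M ^ℚ ((d ℕ.+ k) ∸ j))     ≡⟨ cong (λ e → sign j * ℕ→ℚ (k C j) * (X ^ℚ j * M ^ℚ e)) (ℕ.+-∸-assoc d j≤k) ⟩
      sign j * ℕ→ℚ (k C j) * (X ^ℚ j * M ^ℚ (d ℕ.+ (k ∸ j)))     ≡⟨ cong (λ p → sign j * ℕ→ℚ (k C j) * (X ^ℚ j * p)) (^ℚ-+ M d (k ∸ j)) ⟩
      sign j * ℕ→ℚ (k C j) * (X ^ℚ j * (M ^ℚ d * M ^ℚ (k ∸ j)))  ≡⟨ solve 5 (λ s c x a b → s :* c :* (x :* (a :* b)) := a :* (c :* ((s :* x) :* b)))
                                                                           refl (sign j) (ℕ→ℚ (k C j)) (X ^ℚ j) (M ^ℚ d) (M ^ℚ (k ∸ j)) ⟩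
      M ^ℚ d * (ℕ→ℚ (k C j) * ((sign j * X ^ℚ j) * M ^ℚ (k ∸ j)))
        ≡⟨ cong (λ p → M ^ℚ d * (ℕ→ℚ (k C j) * (p * M ^ℚ (k ∸ j)))) (neg-^ℚ X j) ⟨
      M ^ℚ d * (ℕ→ℚ (k C j) * ((- X) ^ℚ j * M ^ℚ (k ∸ j))) ∎

  sign-even : ∀ k → sign (2 ℕ.* k) ≡ 1ℚ
  sign-even zero    = refl
  sign-even (suc k) = begin
    sign (2 ℕ.* suc k)       ≡⟨ cong sign (ℕ.*-suc 2 k) ⟩
    - - sign (2 ℕ.* k)       ≡⟨ solve 1 (λ s → :- (:- s) := s) refl (sign (2 ℕ.* k)) ⟩
    sign (2 ℕ.* k)           ≡⟨ sign-even k ⟩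
    1ℚ                       ∎
    where open ≡-Reasoning

  sign-odd : ∀ k → sign (2 ℕ.* k ℕ.+ 1) ≡ - 1ℚ
  sign-odd k = trans (cong sign (ℕ.+-comm (2 ℕ.* k) 1)) (cong -_ (sign-even k))

  alternatingSum-parity : ∀ ν (f : ℕ → ℚ) → let L = 2 ℕ.* ν ℕ.+ 2 in
    alternatingSum L f ≡ sumTo (suc ν) (λ k → ℕ→ℚ (L C (2 ℕ.* k)) * f (2 ℕ.* k))
                       - sumTo ν (λ μ → ℕ→ℚ (L C (2 ℕ.* μ ℕ.+ 1)) * f (2 ℕ.* μ ℕ.+ 1))
  alternatingSum-parity ν f = begin
    alternatingSum L f
      ≡⟨ sum-parity ν _ ⟩
    sumTo (suc ν) (λ k → sign (2 ℕ.* k) * e k) + sumTo ν (λ μ → sign (2 ℕ.* μ ℕ.+ 1) * o μ)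
      ≡⟨ cong₂ _+_ (sum-cong (suc ν) even-terms) (trans (sum-cong ν odd-terms) (sym (sum-homo -_ ℚ.neg-distrib-+ ν o))) ⟩
    sumTo (suc ν) e - sumTo ν o ∎
    where
    open ≡-Reasoning
    L : ℕ
    L = 2 ℕ.* ν ℕ.+ 2
    e o : ℕ → ℚ
    e k = ℕ→ℚ (L C (2 ℕ.* k)) * f (2 ℕ.* k)
    o μ = ℕ→ℚ (L C (2 ℕ.* μ ℕ.+ 1)) * f (2 ℕ.* μ ℕ.+ 1)
    even-terms : ∀ k → sign (2 ℕ.* k) * e k ≡ e k
    even-terms k = trans (cong (_* e k) (sign-even k)) (ℚ.*-identityˡ (e k))
    odd-terms : ∀ μ → sign (2 ℕ.* μ ℕ.+ 1) * o μ ≡ - o μ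
    odd-terms μ = trans (cong (_* o μ) (sign-odd μ)) (solve 1 (λ x → (:- con 1ℚ) :* x := :- x) refl (o μ))

  -- Q of the proof idea (M, X standing for m, m − n); P (3 + 2ν) (½ − μ) (M − N) N is its value at 2μ + 1.
  interpolant : ℕ → ℚ → ℚ → ℕ → ℚ
  interpolant K M X i = sumTo K (λ j → binomQ (ℕ→ℚ j - 1ℚ + ℕ→ℚ i * (- ½)) j * (X ^ℚ j * M ^ℚ (K ∸ j)))

  interpolant-degree : ∀ K M X → DegreeBelow (suc K) (interpolant K M X)
  interpolant-degree K M X = degreeBelow-sumTo K {suc K} term term-degree
    where
    term : ℕ → ℕ → ℚ
    term i j = binomQ (ℕ→ℚ j - 1ℚ + ℕ→ℚ i * (- ½)) j * (X ^ℚ j * M ^ℚ (K ∸ j))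
    term-degree : ∀ j → j ≤ K → DegreeBelow (suc K) (λ i → term i j)
    term-degree j j≤K = degreeBelow-≤ {f = λ i → term i j} (s≤s j≤K)
      (degreeBelow-cong (suc j) (λ i → ℚ.*-comm w (b i))
        (degreeBelow-scale (suc j) w b (binomQ-degree (ℕ→ℚ j - 1ℚ) (- ½) j)))
      where
      w : ℚ
      w = X ^ℚ j * M ^ℚ (K ∸ j)
      b : ℕ → ℚ
      b i = binomQ (ℕ→ℚ j - 1ℚ + ℕ→ℚ i * (- ½)) j

  interpolant-even : ∀ K M X k → k ≤ K → interpolant K M X (2 ℕ.* k) ≡ M ^ℚ (K ∸ k) * (M - X) ^ℚ k
  interpolant-even K M X k k≤K = begin
    interpolant K M X (2 ℕ.* k)
      ≡⟨ sum-cong K (λ j → cong (_* (X ^ℚ j * M ^ℚ (K ∸ j))) (trans (cong (λ x → binomQ x j) (upper≡ j)) (binomQ-upper-negation k j))) ⟩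
    sumTo K (λ j → sign j * ℕ→ℚ (k C j) * (X ^ℚ j * M ^ℚ (K ∸ j)))
      ≡⟨ subst (λ K′ → sumTo K′ (λ j → sign j * ℕ→ℚ (k C j) * (X ^ℚ j * M ^ℚ (K′ ∸ j))) ≡ M ^ℚ (K ∸ k) * (M - X) ^ℚ k)
               (ℕ.m∸n+n≡m k≤K) (binomial-expansion-padded (K ∸ k) k M X) ⟩
    M ^ℚ (K ∸ k) * (M - X) ^ℚ k ∎
    where
    open ≡-Reasoning
    upper≡ : ∀ j → ℕ→ℚ j - 1ℚ + ℕ→ℚ (2 ℕ.* k) * (- ½) ≡ ℕ→ℚ j - 1ℚ - ℕ→ℚ k
    upper≡ j = begin
      ℕ→ℚ j - 1ℚ + ℕ→ℚ (2 ℕ.* k) * (- ½)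
        ≡⟨ cong (λ x → ℕ→ℚ j - 1ℚ + x * (- ½)) (ℕ→ℚ-* 2 k) ⟩
      ℕ→ℚ j - 1ℚ + (ℕ→ℚ 2 * ℕ→ℚ k) * (- ½)
        ≡⟨ solve 2 (λ j k → j :- con 1ℚ :+ (con (ℕ→ℚ 2) :* k) :* (:- con ½) := j :- con 1ℚ :- k) refl (ℕ→ℚ j) (ℕ→ℚ k) ⟩
      ℕ→ℚ j - 1ℚ - ℕ→ℚ k ∎

  odd-sum≡even-sum : ∀ ν M X → let K = suc (2 ℕ.* ν); L = 2 ℕ.* ν ℕ.+ 2 in
    sumTo ν (λ μ → ℕ→ℚ (L C (2 ℕ.* μ ℕ.+ 1)) * interpolant K M X (2 ℕ.* μ ℕ.+ 1))
      ≡ sumTo (suc ν) (λ k → ℕ→ℚ (L C (2 ℕ.* k)) * (M ^ℚ (K ∸ k) * (M - X) ^ℚ k))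
  odd-sum≡even-sum ν M X = begin
    Odd
      ≡⟨ solve 2 (λ e o → o := e :- (e :- o)) refl Even Odd ⟩
    Even - (Even - Odd)
      ≡⟨ cong (_-_ Even) (trans (sym (alternatingSum-parity ν Q)) (alternatingSum-vanishes L Q Q-degree)) ⟩
    Even - 0ℚ
      ≡⟨ ℚ.+-identityʳ Even ⟩
    Even
      ≡⟨ sum-cong-≤ (suc ν) (λ k k≤ν+1 → cong (ℕ→ℚ (L C (2 ℕ.* k)) *_) (interpolant-even K M X k (k≤K k≤ν+1))) ⟩
    sumTo (suc ν) (λ k → ℕ→ℚ (L C (2 ℕ.* k)) * (M ^ℚ (K ∸ k) * (M - X) ^ℚ k)) ∎
    where
    open ≡-Reasoning
    K L : ℕ
    K = suc (2 ℕ.* ν)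
    L = 2 ℕ.* ν ℕ.+ 2
    Q : ℕ → ℚ
    Q = interpolant K M X
    Even Odd : ℚ
    Even = sumTo (suc ν) (λ k → ℕ→ℚ (L C (2 ℕ.* k)) * Q (2 ℕ.* k))
    Odd  = sumTo ν (λ μ → ℕ→ℚ (L C (2 ℕ.* μ ℕ.+ 1)) * Q (2 ℕ.* μ ℕ.+ 1))
    Q-degree : DegreeBelow L Q
    Q-degree = subst (λ d → DegreeBelow d Q) (ℕ.+-comm 2 (2 ℕ.* ν)) (interpolant-degree K M X)
    k≤K : ∀ {k} → k ≤ suc ν → k ≤ K
    k≤K k≤ν+1 = ℕ.≤-trans k≤ν+1 (s≤s (ℕ.m≤n*m ν 2))

module QuadraticExtension {m n : ℕ} where
  open import Data.Rational using (_+_; _*_; -_)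
  open import Data.Rational.Solver using (module +-*-Solver)
  open +-*-Solver using (Polynomial; con; var; _:+_; _:*_; :-_; ⟦_⟧; ⟦_⟧↓; prove)
  open import Data.Vec using (Vec; []; _∷_)
  open import Data.Fin using (#_)
  open QR
  open Indices using (even-complement; odd-complement)
  open import Algebra.Structures.Biased (_≡_ {A = QR m n}) using (isCommutativeMonoidˡ; isCommutativeSemiringˡ)

  QR-≡ : ∀ {a b c d a′ b′ c′ d′ : ℚ} → a ≡ a′ → b ≡ b′ → c ≡ c′ → d ≡ d′ →
         _≡_ {A = QR m n} ⟨ a , b , c , d ⟩ ⟨ a′ , b′ , c′ , d′ ⟩
  QR-≡ refl refl refl refl = refl

  -- Elements of QR with polynomial coefficients, variables 0 and 1 standing for m and n.  Evaluation
  -- turns ⊗ᶠ and ⊕ᶠ definitionally into ⊗ and ⊕, so identities in QR reduce to four identities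
  -- checked by the ring solver (formal-≡).
  record Formal (k : ℕ) : Set where
    constructor ⟪_,_,_,_⟫
    field
      f₀ fₓ fᵧ fₓᵧ : Polynomial k
  open Formal

  module _ {k : ℕ} where
    M⁺ N⁺ : Polynomial (2 ℕ.+ k)
    M⁺ = var (# 0)
    N⁺ = var (# 1)

    infixl 6 _⊕ᶠ_
    infixl 7 _⊗ᶠ_

    ιᶠ : Polynomial (2 ℕ.+ k) → Formal (2 ℕ.+ k)
    ιᶠ p = ⟪ p , con 0ℚ , con 0ℚ , con 0ℚ ⟫

    √mᶠ √nᶠ : Formal (2 ℕ.+ k)
    √mᶠ = ⟪ con 0ℚ , con 1ℚ , con 0ℚ , con 0ℚ ⟫
    √nᶠ = ⟪ con 0ℚ , con 0ℚ , con 1ℚ , con 0ℚ ⟫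

    ⊖ᶠ_ : Formal (2 ℕ.+ k) → Formal (2 ℕ.+ k)
    ⊖ᶠ ⟪ a , b , c , d ⟫ = ⟪ :- a , :- b , :- c , :- d ⟫

    _⊕ᶠ_ : Formal (2 ℕ.+ k) → Formal (2 ℕ.+ k) → Formal (2 ℕ.+ k)
    ⟪ a , b , c , d ⟫ ⊕ᶠ ⟪ e , f , g , h ⟫ = ⟪ a :+ e , b :+ f , c :+ g , d :+ h ⟫

    _⊗ᶠ_ : Formal (2 ℕ.+ k) → Formal (2 ℕ.+ k) → Formal (2 ℕ.+ k)
    ⟪ a , b , c , d ⟫ ⊗ᶠ ⟪ e , f , g , h ⟫ =
      ⟪ a :* e :+ M⁺ :* (b :* f) :+ N⁺ :* (c :* g) :+ (M⁺ :* N⁺) :* (d :* h)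
      , a :* f :+ b :* e :+ N⁺ :* (c :* h :+ d :* g)
      , a :* g :+ c :* e :+ M⁺ :* (b :* h :+ d :* f)
      , a :* h :+ d :* e :+ b :* g :+ c :* f ⟫

  ⟦_⟧ᶠ : ∀ {k} → Formal k → Vec ℚ k → QR m n
  ⟦ P ⟧ᶠ ρ = ⟨ ⟦ f₀ P ⟧ ρ , ⟦ fₓ P ⟧ ρ , ⟦ fᵧ P ⟧ ρ , ⟦ fₓᵧ P ⟧ ρ ⟩

  formal-≡ : ∀ {k} (P Q : Formal k) (ρ : Vec ℚ k) →
    ⟦ f₀ P ⟧↓ ρ ≡ ⟦ f₀ Q ⟧↓ ρ → ⟦ fₓ P ⟧↓ ρ ≡ ⟦ fₓ Q ⟧↓ ρ →
    ⟦ fᵧ P ⟧↓ ρ ≡ ⟦ fᵧ Q ⟧↓ ρ → ⟦ fₓᵧ P ⟧↓ ρ ≡ ⟦ fₓᵧ Q ⟧↓ ρ → ⟦ P ⟧ᶠ ρ ≡ ⟦ Q ⟧ᶠ ρ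
  formal-≡ P Q ρ p₀ pₓ pᵧ pₓᵧ =
    QR-≡ (prove ρ (f₀ P) (f₀ Q) p₀) (prove ρ (fₓ P) (fₓ Q) pₓ)
         (prove ρ (fᵧ P) (fᵧ Q) pᵧ) (prove ρ (fₓᵧ P) (fₓᵧ Q) pₓᵧ)

  private
    X Y Z : Formal 14
    X = ⟪ var (# 2) , var (# 3) , var (# 4) , var (# 5) ⟫
    Y = ⟪ var (# 6) , var (# 7) , var (# 8) , var (# 9) ⟫
    Z = ⟪ var (# 10) , var (# 11) , var (# 12) , var (# 13) ⟫
    env : QR m n → QR m n → QR m n → Vec ℚ 14
    env x y z = ℕ→ℚ m ∷ ℕ→ℚ n ∷ c0 x ∷ cx x ∷ cy x ∷ cxy x
              ∷ c0 y ∷ cx y ∷ cy y ∷ cxy y ∷ c0 z ∷ cx z ∷ cy z ∷ cxy z ∷ []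

  ⊗-assoc : (x y z : QR m n) → (x ⊗ y) ⊗ z ≡ x ⊗ (y ⊗ z)
  ⊗-assoc x y z = formal-≡ ((X ⊗ᶠ Y) ⊗ᶠ Z) (X ⊗ᶠ (Y ⊗ᶠ Z)) (env x y z) refl refl refl refl

  ⊗-comm : (x y : QR m n) → x ⊗ y ≡ y ⊗ x
  ⊗-comm x y = formal-≡ (X ⊗ᶠ Y) (Y ⊗ᶠ X) (env x y x) refl refl refl refl

  ⊗-identityˡ : (x : QR m n) → ι 1ℚ ⊗ x ≡ x
  ⊗-identityˡ x = formal-≡ (ιᶠ (con 1ℚ) ⊗ᶠ X) X (env x x x) refl refl refl refl

  ⊗-zeroˡ : (x : QR m n) → ι 0ℚ ⊗ x ≡ ι 0ℚ
  ⊗-zeroˡ x = formal-≡ (ιᶠ (con 0ℚ) ⊗ᶠ X) (ιᶠ (con 0ℚ)) (env x x x) refl refl refl refl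

  ⊗-distribʳ-⊕ : (x y z : QR m n) → (y ⊕ z) ⊗ x ≡ (y ⊗ x) ⊕ (z ⊗ x)
  ⊗-distribʳ-⊕ x y z = formal-≡ ((Y ⊕ᶠ Z) ⊗ᶠ X) (Y ⊗ᶠ X ⊕ᶠ Z ⊗ᶠ X) (env x y z) refl refl refl refl

  ⊕-assoc : (x y z : QR m n) → (x ⊕ y) ⊕ z ≡ x ⊕ (y ⊕ z)
  ⊕-assoc x y z = formal-≡ ((X ⊕ᶠ Y) ⊕ᶠ Z) (X ⊕ᶠ (Y ⊕ᶠ Z)) (env x y z) refl refl refl refl

  ⊕-comm : (x y : QR m n) → x ⊕ y ≡ y ⊕ x
  ⊕-comm x y = formal-≡ (X ⊕ᶠ Y) (Y ⊕ᶠ X) (env x y x) refl refl refl refl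

  ⊕-identityˡ : (x : QR m n) → ι 0ℚ ⊕ x ≡ x
  ⊕-identityˡ x = formal-≡ (ιᶠ (con 0ℚ) ⊕ᶠ X) X (env x x x) refl refl refl refl

  isCommutativeSemiring : IsCommutativeSemiring _≡_ _⊕_ _⊗_ (ι 0ℚ) (ι 1ℚ)
  isCommutativeSemiring = isCommutativeSemiringˡ record
    { +-isCommutativeMonoid = isCommutativeMonoidˡ record
      { isSemigroup = isSemigroup _⊕_ ⊕-assoc
      ; identityˡ   = ⊕-identityˡ
      ; comm        = ⊕-comm
      }
    ; *-isCommutativeMonoid = isCommutativeMonoidˡ record
      { isSemigroup = isSemigroup _⊗_ ⊗-assoc
      ; identityˡ   = ⊗-identityˡ
      ; comm        = ⊗-comm
      }
    ; distribʳ = ⊗-distribʳ-⊕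
    ; zeroˡ    = ⊗-zeroˡ
    }
    where
    isSemigroup : (_∙_ : Op₂ (QR m n)) → (∀ x y z → (x ∙ y) ∙ z ≡ x ∙ (y ∙ z)) → IsSemigroup _≡_ _∙_
    isSemigroup _∙_ assoc = record
      { isMagma = record { isEquivalence = isEquivalence ; ∙-cong = cong₂ _∙_ }
      ; assoc   = assoc
      }

  module QR-Sum = SemiringSum isCommutativeSemiring sumR (λ _ → refl) (λ _ _ → refl)

  ι-⊗ : ∀ a b → ι a ⊗ ι b ≡ ι (a * b)
  ι-⊗ a b = formal-≡ (ιᶠ (var (# 2)) ⊗ᶠ ιᶠ (var (# 3))) (ιᶠ (var (# 2) :* var (# 3)))
                     (ℕ→ℚ m ∷ ℕ→ℚ n ∷ a ∷ b ∷ []) refl refl refl refl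

  √m⊗√m : √m ⊗ √m ≡ ι (ℕ→ℚ m)
  √m⊗√m = formal-≡ (√mᶠ ⊗ᶠ √mᶠ) (ιᶠ M⁺) (ℕ→ℚ m ∷ ℕ→ℚ n ∷ []) refl refl refl refl

  ⊖√n⊗⊖√n : (⊖ √n) ⊗ (⊖ √n) ≡ ι (ℕ→ℚ n)
  ⊖√n⊗⊖√n = formal-≡ ((⊖ᶠ √nᶠ) ⊗ᶠ (⊖ᶠ √nᶠ)) (ιᶠ N⁺) (ℕ→ℚ m ∷ ℕ→ℚ n ∷ []) refl refl refl refl

  ^R-even : ∀ u c → u ⊗ u ≡ ι c → ∀ a → u ^R (2 ℕ.* a) ≡ ι (c ^ℚ a)
  ^R-even u c u²≡c zero    = refl
  ^R-even u c u²≡c (suc a) = begin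
    u ^R (2 ℕ.* suc a)          ≡⟨ cong (u ^R_) (ℕ.*-suc 2 a) ⟩
    u ⊗ (u ⊗ u ^R (2 ℕ.* a))    ≡⟨ ⊗-assoc u u _ ⟨
    (u ⊗ u) ⊗ u ^R (2 ℕ.* a)    ≡⟨ cong₂ _⊗_ u²≡c (^R-even u c u²≡c a) ⟩
    ι c ⊗ ι (c ^ℚ a)            ≡⟨ ι-⊗ c (c ^ℚ a) ⟩
    ι (c ^ℚ suc a)              ∎
    where open ≡-Reasoning

  ^R-odd : ∀ u c → u ⊗ u ≡ ι c → ∀ a → u ^R (2 ℕ.* a ℕ.+ 1) ≡ ι (c ^ℚ a) ⊗ u
  ^R-odd u c u²≡c a = begin
    u ^R (2 ℕ.* a ℕ.+ 1)   ≡⟨ cong (u ^R_) (ℕ.+-comm (2 ℕ.* a) 1) ⟩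
    u ⊗ u ^R (2 ℕ.* a)     ≡⟨ cong (u ⊗_) (^R-even u c u²≡c a) ⟩
    u ⊗ ι (c ^ℚ a)         ≡⟨ ⊗-comm u _ ⟩
    ι (c ^ℚ a) ⊗ u         ∎
    where open ≡-Reasoning

  ^≡^R : ∀ x k → x QR-Sum.^ k ≡ x ^R k
  ^≡^R x zero    = refl
  ^≡^R x (suc k) = cong (x ⊗_) (^≡^R x k)

  ×≡ι⊗ : ∀ c x → c QR-Sum.× x ≡ ι (ℕ→ℚ c) ⊗ x
  ×≡ι⊗ c x = trans (QR-Sum.×≡×1* c x) (cong (_⊗ x) (×ι1≡ι c))
    where
    ×ι1≡ι : ∀ c → c QR-Sum.× ι 1ℚ ≡ ι (ℕ→ℚ c)
    ×ι1≡ι zero    = refl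
    ×ι1≡ι (suc c) = trans (cong (ι 1ℚ ⊕_) (×ι1≡ι c)) (cong ι (sym (ℚ-Arithmetic.ℕ→ℚ-suc c)))

  binomial-theorem-QR : ∀ x y k → (x ⊕ y) ^R k ≡ sumR k (λ j → ι (ℕ→ℚ (k C j)) ⊗ (x ^R j ⊗ y ^R (k ∸ j)))
  binomial-theorem-QR x y k = begin
    (x ⊕ y) ^R k                                               ≡⟨ ^≡^R (x ⊕ y) k ⟨
    (x ⊕ y) QR-Sum.^ k                                         ≡⟨ QR-Sum.binomial-theorem x y k ⟩
    sumR k (λ j → (k C j) QR-Sum.× (x QR-Sum.^ j ⊗ y QR-Sum.^ (k ∸ j)))
      ≡⟨ QR-Sum.sum-cong k (λ j → trans (×≡ι⊗ (k C j) _) (cong (ι (ℕ→ℚ (k C j)) ⊗_) (cong₂ _⊗_ (^≡^R x j) (^≡^R y (k ∸ j))))) ⟩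
    sumR k (λ j → ι (ℕ→ℚ (k C j)) ⊗ (x ^R j ⊗ y ^R (k ∸ j))) ∎
    where open ≡-Reasoning

  sumR-components : ∀ k (a b c d : ℕ → ℚ) →
    sumR {m} {n} k (λ i → ⟨ a i , b i , c i , d i ⟩) ≡ ⟨ sumTo k a , sumTo k b , sumTo k c , sumTo k d ⟩
  sumR-components zero    a b c d = refl
  sumR-components (suc k) a b c d =
    cong (_⊕ ⟨ a (suc k) , b (suc k) , c (suc k) , d (suc k) ⟩) (sumR-components k a b c d)

  evenPart oddPart : ℕ → ℚ
  evenPart ν = sumTo (suc ν) (λ k → ℕ→ℚ ((2 ℕ.* ν ℕ.+ 2) C (2 ℕ.* k)) * (ℕ→ℚ n ^ℚ k * ℕ→ℚ m ^ℚ (suc ν ∸ k)))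
  oddPart  ν = sumTo ν (λ μ → ℕ→ℚ ((2 ℕ.* ν ℕ.+ 2) C (2 ℕ.* μ ℕ.+ 1)) * - (ℕ→ℚ n ^ℚ μ * ℕ→ℚ m ^ℚ (ν ∸ μ)))

  √m⊖√n^even : ∀ ν → (√m ⊖ √n) ^R (2 ℕ.* ν ℕ.+ 2) ≡ ⟨ evenPart ν , 0ℚ , 0ℚ , oddPart ν ⟩
  √m⊖√n^even ν = begin
    (√m ⊕ ⊖ √n) ^R L
      ≡⟨ cong (_^R L) (⊕-comm √m (⊖ √n)) ⟩
    (⊖ √n ⊕ √m) ^R L
      ≡⟨ binomial-theorem-QR (⊖ √n) √m L ⟩
    sumR L term
      ≡⟨ QR-Sum.sum-parity ν term ⟩
    sumR (suc ν) (λ k → term (2 ℕ.* k)) ⊕ sumR ν (λ μ → term (2 ℕ.* μ ℕ.+ 1))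
      ≡⟨ cong₂ _⊕_ (QR-Sum.sum-cong (suc ν) even-term) (QR-Sum.sum-cong-≤ ν odd-term) ⟩
    sumR (suc ν) (λ k → ⟨ e k , 0ℚ , 0ℚ , 0ℚ ⟩) ⊕ sumR ν (λ μ → ⟨ 0ℚ , 0ℚ , 0ℚ , o μ ⟩)
      ≡⟨ cong₂ _⊕_ (sumR-components (suc ν) e zeros zeros zeros) (sumR-components ν zeros zeros zeros o) ⟩
    ⟨ evenPart ν , Σ0 (suc ν) , Σ0 (suc ν) , Σ0 (suc ν) ⟩ ⊕ ⟨ Σ0 ν , Σ0 ν , Σ0 ν , oddPart ν ⟩
      ≡⟨ QR-≡ (trans (cong (evenPart ν +_) (Σ0≡0 ν)) (ℚ.+-identityʳ (evenPart ν)))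
              (cong₂ _+_ (Σ0≡0 (suc ν)) (Σ0≡0 ν)) (cong₂ _+_ (Σ0≡0 (suc ν)) (Σ0≡0 ν))
              (trans (cong (_+ oddPart ν) (Σ0≡0 (suc ν))) (ℚ.+-identityˡ (oddPart ν))) ⟩
    ⟨ evenPart ν , 0ℚ , 0ℚ , oddPart ν ⟩ ∎
    where
    open ≡-Reasoning
    L : ℕ
    L = 2 ℕ.* ν ℕ.+ 2
    term : ℕ → QR m n
    term j = ι (ℕ→ℚ (L C j)) ⊗ ((⊖ √n) ^R j ⊗ √m ^R (L ∸ j))
    e o zeros : ℕ → ℚ
    e k = ℕ→ℚ (L C (2 ℕ.* k)) * (ℕ→ℚ n ^ℚ k * ℕ→ℚ m ^ℚ (suc ν ∸ k))
    o μ = ℕ→ℚ (L C (2 ℕ.* μ ℕ.+ 1)) * - (ℕ→ℚ n ^ℚ μ * ℕ→ℚ m ^ℚ (ν ∸ μ))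
    zeros _ = 0ℚ
    Σ0 : ℕ → ℚ
    Σ0 k = sumTo k zeros
    Σ0≡0 : ∀ k → Σ0 k ≡ 0ℚ
    Σ0≡0 k = ℚ-Sum.sum-vanishing k zeros (λ _ _ → refl)
    even-term : ∀ k → term (2 ℕ.* k) ≡ ⟨ e k , 0ℚ , 0ℚ , 0ℚ ⟩
    even-term k = begin
      ι c ⊗ ((⊖ √n) ^R (2 ℕ.* k) ⊗ √m ^R (L ∸ 2 ℕ.* k))
        ≡⟨ cong (λ j → ι c ⊗ ((⊖ √n) ^R (2 ℕ.* k) ⊗ √m ^R j)) L∸2k ⟩
      ι c ⊗ ((⊖ √n) ^R (2 ℕ.* k) ⊗ √m ^R (2 ℕ.* (suc ν ∸ k)))
        ≡⟨ cong₂ (λ u v → ι c ⊗ (u ⊗ v)) (^R-even (⊖ √n) (ℕ→ℚ n) ⊖√n⊗⊖√n k) (^R-even √m (ℕ→ℚ m) √m⊗√m (suc ν ∸ k)) ⟩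
      ι c ⊗ (ι (ℕ→ℚ n ^ℚ k) ⊗ ι (ℕ→ℚ m ^ℚ (suc ν ∸ k)))
        ≡⟨ trans (cong (ι c ⊗_) (ι-⊗ (ℕ→ℚ n ^ℚ k) (ℕ→ℚ m ^ℚ (suc ν ∸ k)))) (ι-⊗ c (ℕ→ℚ n ^ℚ k * ℕ→ℚ m ^ℚ (suc ν ∸ k))) ⟩
      ι (e k) ∎
      where
      c : ℚ
      c = ℕ→ℚ (L C (2 ℕ.* k))
      L∸2k : L ∸ 2 ℕ.* k ≡ 2 ℕ.* (suc ν ∸ k)
      L∸2k = even-complement ν k
    odd-term : ∀ μ → μ ≤ ν → term (2 ℕ.* μ ℕ.+ 1) ≡ ⟨ 0ℚ , 0ℚ , 0ℚ , o μ ⟩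
    odd-term μ μ≤ν = begin
      ι c ⊗ ((⊖ √n) ^R (2 ℕ.* μ ℕ.+ 1) ⊗ √m ^R (L ∸ (2 ℕ.* μ ℕ.+ 1)))
        ≡⟨ cong (λ j → ι c ⊗ ((⊖ √n) ^R (2 ℕ.* μ ℕ.+ 1) ⊗ √m ^R j)) L∸2μ+1 ⟩
      ι c ⊗ ((⊖ √n) ^R (2 ℕ.* μ ℕ.+ 1) ⊗ √m ^R (2 ℕ.* (ν ∸ μ) ℕ.+ 1))
        ≡⟨ cong₂ (λ u v → ι c ⊗ (u ⊗ v)) (^R-odd (⊖ √n) (ℕ→ℚ n) ⊖√n⊗⊖√n μ) (^R-odd √m (ℕ→ℚ m) √m⊗√m (ν ∸ μ)) ⟩
      ι c ⊗ ((ι a ⊗ ⊖ √n) ⊗ (ι b ⊗ √m))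
        ≡⟨ formal-≡ (ιᶠ (var (# 2)) ⊗ᶠ ((ιᶠ (var (# 3)) ⊗ᶠ ⊖ᶠ √nᶠ) ⊗ᶠ (ιᶠ (var (# 4)) ⊗ᶠ √mᶠ)))
                    ⟪ con 0ℚ , con 0ℚ , con 0ℚ , var (# 2) :* :- (var (# 3) :* var (# 4)) ⟫
                    (ℕ→ℚ m ∷ ℕ→ℚ n ∷ c ∷ a ∷ b ∷ []) refl refl refl refl ⟩
      ⟨ 0ℚ , 0ℚ , 0ℚ , o μ ⟩ ∎
      where
      c a b : ℚ
      c = ℕ→ℚ (L C (2 ℕ.* μ ℕ.+ 1))
      a = ℕ→ℚ n ^ℚ μ
      b = ℕ→ℚ m ^ℚ (ν ∸ μ)
      L∸2μ+1 : L ∸ (2 ℕ.* μ ℕ.+ 1) ≡ 2 ℕ.* (ν ∸ μ) ℕ.+ 1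
      L∸2μ+1 = odd-complement μ≤ν

module Proposition (m n ν : ℕ) .{{_ : NonZero m}} where
  open import Data.Rational using (_+_; _*_; _-_; -_)
  open import Data.Rational.Solver using (module +-*-Solver)
  open +-*-Solver
  open ℚ-Arithmetic
  open ℚ-Sum using (sum-cong; sum-cong-≤; *-distribˡ-sum)
  open HalfIntegerBinomial using (centralFactor; halfBinomialProduct≡)
  open ParityIdentity using (interpolant; odd-sum≡even-sum)
  open QuadraticExtension {m} {n}
  open import Data.Fin using (#_)
  open import Data.Vec using ([]; _∷_)

  M N c r : ℚ
  M = ℕ→ℚ m
  N = ℕ→ℚ n
  c = centralFactor ν
  r = recip (m ℕ.^ 1)

  L : ℕ
  L = 2 ℕ.* ν ℕ.+ 2

  a z p w : ℕ → ℚ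
  a μ = binomQ (½ + ℕ→ℚ ν) (ν ∸ μ) * binomQ (½ + ℕ→ℚ ν) μ * zpow m (ℤ.+ (ν ∸ μ))
  z μ = zpow m ((ℤ.+ μ ℤ.- ℤ.+ (2 ℕ.* ν)) ℤ.- ℤ.+ 1)
  p μ = P (3 ℕ.+ 2 ℕ.* ν) (½ - ℕ→ℚ μ) (M - N) N
  w μ = zpow n (ℤ.+ μ)

  ℕ→ℚ-m^*recip : ∀ i j → ℕ→ℚ (m ℕ.^ i) * recip (m ℕ.^ (i ℕ.+ j)) ≡ recip (m ℕ.^ j)
  ℕ→ℚ-m^*recip i j = begin
    ℕ→ℚ (m ℕ.^ i) * recip (m ℕ.^ (i ℕ.+ j))
      ≡⟨ cong (λ k → ℕ→ℚ (m ℕ.^ i) * recip k) (ℕ.^-distribˡ-+-* m i j) ⟩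
    ℕ→ℚ (m ℕ.^ i) * recip (m ℕ.^ i ℕ.* m ℕ.^ j)
      ≡⟨ *-recip-* (m ℕ.^ i) (m ℕ.^ j) {{ℕ.m^n≢0 m i}} {{ℕ.m^n≢0 m j}} ⟩
    recip (m ℕ.^ j) ∎
    where open ≡-Reasoning

  M*r≡1 : M * r ≡ 1ℚ
  M*r≡1 = trans (cong (λ k → ℕ→ℚ k * r) (sym (ℕ.*-identityʳ m))) (*-recip (m ℕ.^ 1) {{ℕ.m^n≢0 m 1}})

  a≡ : ∀ μ → μ ≤ ν → a μ ≡ c * ℕ→ℚ (L C (2 ℕ.* μ ℕ.+ 1)) * M ^ℚ (ν ∸ μ)
  a≡ μ μ≤ν = cong₂ _*_ (halfBinomialProduct≡ ν μ μ≤ν) (ℕ→ℚ-^ m (ν ∸ μ))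

  exponent≡ : ∀ μ → μ ≤ ν → (ℤ.+ μ ℤ.- ℤ.+ (2 ℕ.* ν)) ℤ.- ℤ.+ 1 ≡ ℤ.-[1+ (2 ℕ.* ν ∸ μ) ]
  exponent≡ μ μ≤ν = begin
    (ℤ.+ μ ℤ.- ℤ.+ (2 ℕ.* ν)) ℤ.- ℤ.+ 1
      ≡⟨ cong (ℤ._- ℤ.+ 1) (ℤ.[+m]-[+n]≡m⊖n μ (2 ℕ.* ν)) ⟩
    (μ ℤ.⊖ 2 ℕ.* ν) ℤ.+ ℤ.-[1+ 0 ]
      ≡⟨ cong (λ k → (μ ℤ.⊖ k) ℤ.+ ℤ.-[1+ 0 ]) (ℕ.m+[n∸m]≡n μ≤2ν) ⟨
    (μ ℤ.⊖ (μ ℕ.+ d)) ℤ.+ ℤ.-[1+ 0 ]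
      ≡⟨ cong (λ k → (k ℤ.⊖ (μ ℕ.+ d)) ℤ.+ ℤ.-[1+ 0 ]) (ℕ.+-identityʳ μ) ⟨
    ((μ ℕ.+ 0) ℤ.⊖ (μ ℕ.+ d)) ℤ.+ ℤ.-[1+ 0 ]
      ≡⟨ cong (ℤ._+ ℤ.-[1+ 0 ]) (ℤ.+-cancelˡ-⊖ μ 0 d) ⟩
    (0 ℤ.⊖ d) ℤ.+ ℤ.-[1+ 0 ]
      ≡⟨ ℤ.distribˡ-⊖-+-neg 0 0 d ⟩
    0 ℤ.⊖ suc (d ℕ.+ 0)
      ≡⟨ cong (λ k → 0 ℤ.⊖ suc k) (ℕ.+-identityʳ d) ⟩
    ℤ.-[1+ d ] ∎
    where
    open ≡-Reasoning
    d : ℕ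
    d = 2 ℕ.* ν ∸ μ
    μ≤2ν : μ ≤ 2 ℕ.* ν
    μ≤2ν = ℕ.≤-trans μ≤ν (ℕ.m≤n*m ν 2)

  a*z≡ : ∀ μ → μ ≤ ν → a μ * z μ ≡ c * ℕ→ℚ (L C (2 ℕ.* μ ℕ.+ 1)) * recip (m ℕ.^ suc ν)
  a*z≡ μ μ≤ν = begin
    a μ * z μ
      ≡⟨ cong₂ _*_ (a≡ μ μ≤ν) (cong (zpow m) (exponent≡ μ μ≤ν)) ⟩
    c * b * M ^ℚ (ν ∸ μ) * recip (m ℕ.^ suc (2 ℕ.* ν ∸ μ))
      ≡⟨ ℚ.*-assoc (c * b) _ _ ⟩
    c * b * (M ^ℚ (ν ∸ μ) * recip (m ℕ.^ suc (2 ℕ.* ν ∸ μ)))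
      ≡⟨ cong (λ x → c * b * (x * recip (m ℕ.^ suc (2 ℕ.* ν ∸ μ)))) (ℕ→ℚ-^ m (ν ∸ μ)) ⟨
    c * b * (ℕ→ℚ (m ℕ.^ (ν ∸ μ)) * recip (m ℕ.^ suc (2 ℕ.* ν ∸ μ)))
      ≡⟨ cong (λ e → c * b * (ℕ→ℚ (m ℕ.^ (ν ∸ μ)) * recip (m ℕ.^ e))) (Indices.[ν∸μ]+[1+ν]≡1+[2ν∸μ] μ≤ν) ⟨
    c * b * (ℕ→ℚ (m ℕ.^ (ν ∸ μ)) * recip (m ℕ.^ ((ν ∸ μ) ℕ.+ suc ν)))
      ≡⟨ cong (c * b *_) (ℕ→ℚ-m^*recip (ν ∸ μ) (suc ν)) ⟩
    c * b * recip (m ℕ.^ suc ν) ∎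
    where
    open ≡-Reasoning
    b : ℚ
    b = ℕ→ℚ (L C (2 ℕ.* μ ℕ.+ 1))

  p≡ : ∀ μ → p μ ≡ interpolant (suc (2 ℕ.* ν)) M (M - N) (2 ℕ.* μ ℕ.+ 1)
  p≡ μ = sum-cong (suc (2 ℕ.* ν)) (λ j → cong₂ (λ x y → binomQ x j * ((M - N) ^ℚ j * y)) (upper≡ j) (power≡ j))
    where
    open ≡-Reasoning
    upper≡ : ∀ j → (ℕ→ℚ j + (½ - ℕ→ℚ μ)) - ℕ→ℚ 2 ≡ ℕ→ℚ j - 1ℚ + ℕ→ℚ (2 ℕ.* μ ℕ.+ 1) * (- ½)
    upper≡ j = begin
      (ℕ→ℚ j + (½ - ℕ→ℚ μ)) - ℕ→ℚ 2
        ≡⟨ solve 2 (λ j u → (j :+ (con ½ :- u)) :- con (ℕ→ℚ 2) := j :- con 1ℚ :+ (con (ℕ→ℚ 2) :* u :+ con (ℕ→ℚ 1)) :* (:- con ½))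
                   refl (ℕ→ℚ j) (ℕ→ℚ μ) ⟩
      ℕ→ℚ j - 1ℚ + (ℕ→ℚ 2 * ℕ→ℚ μ + ℕ→ℚ 1) * (- ½)
        ≡⟨ cong (λ x → ℕ→ℚ j - 1ℚ + x * (- ½)) (ℕ→ℚ-affine 2 μ 1) ⟨
      ℕ→ℚ j - 1ℚ + ℕ→ℚ (2 ℕ.* μ ℕ.+ 1) * (- ½) ∎
    power≡ : ∀ j → ((M - N) + N) ^ℚ ((3 ℕ.+ 2 ℕ.* ν ∸ j) ∸ 2) ≡ M ^ℚ (suc (2 ℕ.* ν) ∸ j)
    power≡ j = cong₂ _^ℚ_ (solve 2 (λ M N → (M :- N) :+ N := M) refl M N) (begin
      (3 ℕ.+ 2 ℕ.* ν ∸ j) ∸ 2      ≡⟨ ℕ.∸-+-assoc (3 ℕ.+ 2 ℕ.* ν) j 2 ⟩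
      3 ℕ.+ 2 ℕ.* ν ∸ (j ℕ.+ 2)    ≡⟨ cong (3 ℕ.+ 2 ℕ.* ν ∸_) (ℕ.+-comm j 2) ⟩
      3 ℕ.+ 2 ℕ.* ν ∸ (2 ℕ.+ j)    ≡⟨ ℕ.∸-+-assoc (3 ℕ.+ 2 ℕ.* ν) 2 j ⟨
      suc (2 ℕ.* ν) ∸ j            ∎)

  √m-component : c * r * evenPart ν ≡ sumTo ν (λ μ → a μ * (z μ * p μ))
  √m-component = sym (begin
    sumTo ν (λ μ → a μ * (z μ * p μ))
      ≡⟨ sum-cong-≤ ν odd-term ⟩
    sumTo ν (λ μ → (c * r′) * (ℕ→ℚ (L C (2 ℕ.* μ ℕ.+ 1)) * Q (2 ℕ.* μ ℕ.+ 1)))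
      ≡⟨ *-distribˡ-sum (c * r′) ν _ ⟨
    (c * r′) * sumTo ν (λ μ → ℕ→ℚ (L C (2 ℕ.* μ ℕ.+ 1)) * Q (2 ℕ.* μ ℕ.+ 1))
      ≡⟨ cong ((c * r′) *_) (odd-sum≡even-sum ν M (M - N)) ⟩
    (c * r′) * sumTo (suc ν) (λ k → ℕ→ℚ (L C (2 ℕ.* k)) * (M ^ℚ (K ∸ k) * (M - (M - N)) ^ℚ k))
      ≡⟨ cong ((c * r′) *_) (trans (sum-cong-≤ (suc ν) even-term) (sym (*-distribˡ-sum (M ^ℚ ν) (suc ν) _))) ⟩
    (c * r′) * (M ^ℚ ν * evenPart ν)
      ≡⟨ solve 4 (λ c r x A → (c :* r) :* (x :* A) := c :* (r :* x) :* A) refl c r′ (M ^ℚ ν) (evenPart ν) ⟩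
    c * (r′ * M ^ℚ ν) * evenPart ν
      ≡⟨ cong (λ x → c * x * evenPart ν) r′*M^ν≡r ⟩
    c * r * evenPart ν ∎)
    where
    open ≡-Reasoning
    K : ℕ
    K = suc (2 ℕ.* ν)
    Q : ℕ → ℚ
    Q = interpolant K M (M - N)
    r′ : ℚ
    r′ = recip (m ℕ.^ suc ν)
    odd-term : ∀ μ → μ ≤ ν → a μ * (z μ * p μ) ≡ (c * r′) * (ℕ→ℚ (L C (2 ℕ.* μ ℕ.+ 1)) * Q (2 ℕ.* μ ℕ.+ 1))
    odd-term μ μ≤ν = begin
      a μ * (z μ * p μ)
        ≡⟨ ℚ.*-assoc (a μ) (z μ) (p μ) ⟨
      (a μ * z μ) * p μ
        ≡⟨ cong₂ _*_ (a*z≡ μ μ≤ν) (p≡ μ) ⟩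
      c * b * r′ * Q (2 ℕ.* μ ℕ.+ 1)
        ≡⟨ solve 4 (λ c b r q → c :* b :* r :* q := (c :* r) :* (b :* q)) refl c b r′ (Q (2 ℕ.* μ ℕ.+ 1)) ⟩
      (c * r′) * (b * Q (2 ℕ.* μ ℕ.+ 1)) ∎
      where
      b : ℚ
      b = ℕ→ℚ (L C (2 ℕ.* μ ℕ.+ 1))
    even-term : ∀ k → k ≤ suc ν → ℕ→ℚ (L C (2 ℕ.* k)) * (M ^ℚ (K ∸ k) * (M - (M - N)) ^ℚ k)
                                 ≡ M ^ℚ ν * (ℕ→ℚ (L C (2 ℕ.* k)) * (N ^ℚ k * M ^ℚ (suc ν ∸ k)))
    even-term k k≤ν+1 = begin
      b * (M ^ℚ (K ∸ k) * (M - (M - N)) ^ℚ k)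
        ≡⟨ cong₂ (λ e x → b * (M ^ℚ e * x ^ℚ k)) (Indices.[1+2ν]∸k≡ν+[1+ν∸k] k≤ν+1) (solve 2 (λ M N → M :- (M :- N) := N) refl M N) ⟩
      b * (M ^ℚ (ν ℕ.+ (suc ν ∸ k)) * N ^ℚ k)
        ≡⟨ cong (λ x → b * (x * N ^ℚ k)) (^ℚ-+ M ν (suc ν ∸ k)) ⟩
      b * ((M ^ℚ ν * M ^ℚ (suc ν ∸ k)) * N ^ℚ k)
        ≡⟨ solve 4 (λ b x y n → b :* ((x :* y) :* n) := x :* (b :* (n :* y))) refl b (M ^ℚ ν) (M ^ℚ (suc ν ∸ k)) (N ^ℚ k) ⟩
      M ^ℚ ν * (b * (N ^ℚ k * M ^ℚ (suc ν ∸ k))) ∎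
      where
      b : ℚ
      b = ℕ→ℚ (L C (2 ℕ.* k))
    r′*M^ν≡r : r′ * M ^ℚ ν ≡ r
    r′*M^ν≡r = begin
      r′ * M ^ℚ ν
        ≡⟨ ℚ.*-comm r′ (M ^ℚ ν) ⟩
      M ^ℚ ν * r′
        ≡⟨ cong₂ (λ x e → x * recip (m ℕ.^ e)) (ℕ→ℚ-^ m ν) (ℕ.+-comm ν 1) ⟨
      ℕ→ℚ (m ℕ.^ ν) * recip (m ℕ.^ (ν ℕ.+ 1))
        ≡⟨ ℕ→ℚ-m^*recip ν 1 ⟩
      r ∎

  √n-component : M * (c * r * oddPart ν) ≡ sumTo ν (λ μ → - (a μ * w μ))
  √n-component = begin
    M * (c * r * oddPart ν)
      ≡⟨ solve 4 (λ M c r B → M :* (c :* r :* B) := (M :* r) :* (c :* B)) refl M c r (oddPart ν) ⟩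
    (M * r) * (c * oddPart ν)
      ≡⟨ cong (_* (c * oddPart ν)) M*r≡1 ⟩
    1ℚ * (c * oddPart ν)
      ≡⟨ ℚ.*-identityˡ (c * oddPart ν) ⟩
    c * oddPart ν
      ≡⟨ *-distribˡ-sum c ν _ ⟩
    sumTo ν (λ μ → c * (ℕ→ℚ (L C (2 ℕ.* μ ℕ.+ 1)) * - (N ^ℚ μ * M ^ℚ (ν ∸ μ))))
      ≡⟨ sum-cong-≤ ν term ⟩
    sumTo ν (λ μ → - (a μ * w μ)) ∎
    where
    open ≡-Reasoning
    term : ∀ μ → μ ≤ ν → c * (ℕ→ℚ (L C (2 ℕ.* μ ℕ.+ 1)) * - (N ^ℚ μ * M ^ℚ (ν ∸ μ))) ≡ - (a μ * w μ)
    term μ μ≤ν = begin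
      c * (b * - (N ^ℚ μ * M ^ℚ (ν ∸ μ)))
        ≡⟨ solve 4 (λ c b x y → c :* (b :* :- (x :* y)) := :- ((c :* b :* y) :* x)) refl c b (N ^ℚ μ) (M ^ℚ (ν ∸ μ)) ⟩
      - ((c * b * M ^ℚ (ν ∸ μ)) * N ^ℚ μ)
        ≡⟨ cong₂ (λ x y → - (x * y)) (a≡ μ μ≤ν) (ℕ→ℚ-^ n μ) ⟨
      - (a μ * w μ) ∎
      where
      b : ℚ
      b = ℕ→ℚ (L C (2 ℕ.* μ ℕ.+ 1))

  identity : ι c ⊗ m^[ ℤ.-[1+ 0 ] +½] ⊗ ((√m ⊖ √n) ^R (2 ℕ.* ν ℕ.+ 2))
           ≡ sumR {m} {n} ν (λ μ → ι (a μ) ⊗ (m^[ (ℤ.+ μ ℤ.- ℤ.+ (2 ℕ.* ν)) ℤ.- ℤ.+ 1 +½] ⊗ ι (p μ) ⊖ n^[ ℤ.+ μ +½]))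
  identity = begin
    ι c ⊗ (ι r ⊗ √m) ⊗ ((√m ⊖ √n) ^R (2 ℕ.* ν ℕ.+ 2))
      ≡⟨ cong (ι c ⊗ (ι r ⊗ √m) ⊗_) (√m⊖√n^even ν) ⟩
    ι c ⊗ (ι r ⊗ √m) ⊗ ⟨ evenPart ν , 0ℚ , 0ℚ , oddPart ν ⟩
      ≡⟨ formal-≡ (ιᶠ (var (# 2)) ⊗ᶠ (ιᶠ (var (# 3)) ⊗ᶠ √mᶠ) ⊗ᶠ ⟪ var (# 4) , con 0ℚ , con 0ℚ , var (# 5) ⟫)
                  ⟪ con 0ℚ , var (# 2) :* var (# 3) :* var (# 4) , M⁺ :* (var (# 2) :* var (# 3) :* var (# 5)) , con 0ℚ ⟫
                  (M ∷ N ∷ c ∷ r ∷ evenPart ν ∷ oddPart ν ∷ []) refl refl refl refl ⟩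
    ⟨ 0ℚ , c * r * evenPart ν , M * (c * r * oddPart ν) , 0ℚ ⟩
      ≡⟨ QR-≡ (sym (Σ0≡0 ν)) √m-component √n-component (sym (Σ0≡0 ν)) ⟩
    ⟨ sumTo ν zeros , sumTo ν (λ μ → a μ * (z μ * p μ)) , sumTo ν (λ μ → - (a μ * w μ)) , sumTo ν zeros ⟩
      ≡⟨ sumR-components ν zeros (λ μ → a μ * (z μ * p μ)) (λ μ → - (a μ * w μ)) zeros ⟨
    sumR ν (λ μ → ⟨ 0ℚ , a μ * (z μ * p μ) , - (a μ * w μ) , 0ℚ ⟩)
      ≡⟨ QR-Sum.sum-cong ν term ⟨
    sumR ν (λ μ → ι (a μ) ⊗ ((ι (z μ) ⊗ √m) ⊗ ι (p μ) ⊖ ι (w μ) ⊗ √n)) ∎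
    where
    open ≡-Reasoning
    zeros : ℕ → ℚ
    zeros _ = 0ℚ
    Σ0≡0 : ∀ k → sumTo k zeros ≡ 0ℚ
    Σ0≡0 k = ℚ-Sum.sum-vanishing k zeros (λ _ _ → refl)
    term : ∀ μ → ι (a μ) ⊗ ((ι (z μ) ⊗ √m) ⊗ ι (p μ) ⊖ ι (w μ) ⊗ √n) ≡ ⟨ 0ℚ , a μ * (z μ * p μ) , - (a μ * w μ) , 0ℚ ⟩
    term μ = formal-≡ (ιᶠ (var (# 2)) ⊗ᶠ ((ιᶠ (var (# 3)) ⊗ᶠ √mᶠ) ⊗ᶠ ιᶠ (var (# 4)) ⊕ᶠ ⊖ᶠ (ιᶠ (var (# 5)) ⊗ᶠ √nᶠ)))
                      ⟪ con 0ℚ , var (# 2) :* (var (# 3) :* var (# 4)) , :- (var (# 2) :* var (# 5)) , con 0ℚ ⟫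
                      (M ∷ N ∷ a μ ∷ z μ ∷ p μ ∷ w μ ∷ []) refl refl refl refl

open import Data.Nat using (ℕ; _<_; _+_; _*_; _∸_)
open import Data.Integer using (+_; -[1+_])
open import Data.Integer as ℤ using ()
open import Data.Rational as ℚ using ()

proposition4p2 : (m n ν : ℕ) → 0 < n → n < m →
    ι (recip (2 Data.Nat.^ (2 * ν + 1)) ℚ.* ℕ→ℚ ((2 * ν + 1) C (ν + 1)))
      ⊗ m^[ -[1+ 0 ] +½] ⊗ ((√m ⊖ √n) ^R (2 * ν + 2))
    ≡ sumR {m} {n} ν (λ μ →
        ι (binomQ (½ ℚ.+ ℕ→ℚ ν) (ν ∸ μ) ℚ.* binomQ (½ ℚ.+ ℕ→ℚ ν) μ ℚ.* zpow m (+ (ν ∸ μ)))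
        ⊗ (m^[ (+ μ ℤ.- + (2 * ν)) ℤ.- + 1 +½]
             ⊗ ι (P (3 + 2 * ν) (½ ℚ.- ℕ→ℚ μ) (ℕ→ℚ m ℚ.- ℕ→ℚ n) (ℕ→ℚ n))
           ⊖ n^[ + μ +½]))
proposition4p2 m n ν 0<n n<m = Proposition.identity m n ν {{m-nonZero}}
  where
  -- The identity is formal in ℚ(√m, √n): 0 < n < m is used only to get m ≠ 0.
  m-nonZero : NonZero m
  m-nonZero = ℕ.>-nonZero (ℕ.<-trans 0<n n<m)
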